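{- Let $\mathscr{P}_{T_{\mathrm{I}}}$ be the set of partitions $\lambda_1\ge\lambda_2\ge\cdots\ge\lambda_\ell\ge1$ (empty partition included) with $\lambda_i-\lambda_{i+2}\ge 3$ for all applicable $i$, and such that $\lambda_i-\lambda_{i+1}\le 1$ implies $\lambda_i+\lambda_{i+1}\equiv 0\pmod 3$. Let $G(x)=G(x,q)=\sum_{\lambda}x^{\sharp(\lambda)}q^{|\lambda|}$ over those $\lambda\in\mathscr{P}_{T_{\mathrm{I}}}$ whose smallest part is at least $3$ (empty partition included), where $\sharp(\lambda)$ is the number of parts and $|\lambda|$ the sum of parts. Then $$p_0(x,q)G(x)+p_3(x,q)G(xq^3)+p_6(x,q)G(xq^6)+p_9(x,q)G(xq^9)=0,$$ where \begin{align*} p_0&=1+x(q^6+q^7),\\ p_3&=-1-x(q^3+q^4+q^5+q^6+q^7)-x^2(q^6+q^8+2q^9+2q^{10}+q^{11}+q^{12})-x^3(q^{12}+q^{13}+q^{15}+q^{16}),\\ p_6&=x^3(q^{16}+q^{17})+x^4(q^{20}+q^{21}+q^{22}+q^{23}+q^{24})+x^5(q^{27}+q^{28}),\\ p_9&=x^5q^{36}+x^6(q^{39}+q^{40}). \end{align*} -}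

module Defs where

open import Data.Nat as ℕ using (ℕ; zero; suc; _≤_; _∸_; _≤?_; _%_; _≟_)
open import Data.Integer as ℤ using (ℤ; +_; 0ℤ; -_)
open import Data.List using (List; []; _∷_; length; filter; map; concatMap; upTo; foldr)
open import Data.Nat.ListAction using (sum)
open import Data.Product using (_×_; _,_)
open import Data.Unit using (⊤; tt)
open import Relation.Nullary using (Dec; yes; no; ¬_)
open import Relation.Nullary.Decidable using (_×-dec_; _→-dec_)
open import Relation.Binary.PropositionalEquality using (_≡_)

-- Partitions are lists of parts  λ₁ ∷ λ₂ ∷ … ∷ λ_ℓ ∷ []  (largest first).

PairOK : ℕ → ℕ → Set
PairOK a b = (b ≤ a) × ((a ∸ b ≤ 1) → (a ℕ.+ b) % 3 ≡ 0)

TripleOK : ℕ → ℕ → Set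
TripleOK a c = 3 ℕ.+ c ≤ a

data InPTI : List ℕ → Set where
  nil   : InPTI []
  one   : ∀ {a} → 1 ≤ a → InPTI (a ∷ [])
  two   : ∀ {a b} → 1 ≤ a → 1 ≤ b → PairOK a b → InPTI (a ∷ b ∷ [])
  more  : ∀ {a b c rest} → 1 ≤ a → PairOK a b → TripleOK a c →
          InPTI (b ∷ c ∷ rest) → InPTI (a ∷ b ∷ c ∷ rest)

data AllGe3 : List ℕ → Set where
  []  : AllGe3 []
  _∷_ : ∀ {a rest} → 3 ≤ a → AllGe3 rest → AllGe3 (a ∷ rest)

pairOK? : ∀ a b → Dec (PairOK a b)
pairOK? a b = (b ≤? a) ×-dec ((a ∸ b ≤? 1) →-dec ((a ℕ.+ b) % 3 ≟ 0))

inPTI? : ∀ xs → Dec (InPTI xs)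
inPTI? [] = yes nil
inPTI? (a ∷ []) with 1 ≤? a
... | yes p = yes (one p)
... | no ¬p = no λ { (one p) → ¬p p }
inPTI? (a ∷ b ∷ []) with 1 ≤? a | 1 ≤? b | pairOK? a b
... | yes p | yes q | yes r = yes (two p q r)
... | no ¬p | _ | _ = no λ { (two p _ _) → ¬p p }
... | yes _ | no ¬q | _ = no λ { (two _ q _) → ¬q q }
... | yes _ | yes _ | no ¬r = no λ { (two _ _ r) → ¬r r }
inPTI? (a ∷ b ∷ c ∷ rest) with 1 ≤? a | pairOK? a b | 3 ℕ.+ c ≤? a | inPTI? (b ∷ c ∷ rest)
... | yes p | yes q | yes r | yes s = yes (more p q r s)
... | no ¬p | _ | _ | _ = no λ { (more p _ _ _) → ¬p p }
... | yes _ | no ¬q | _ | _ = no λ { (more _ q _ _) → ¬q q }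
... | yes _ | yes _ | no ¬r | _ = no λ { (more _ _ r _) → ¬r r }
... | yes _ | yes _ | yes _ | no ¬s = no λ { (more _ _ _ s) → ¬s s }

allGe3? : ∀ xs → Dec (AllGe3 xs)
allGe3? [] = yes []
allGe3? (a ∷ rest) with 3 ≤? a | allGe3? rest
... | yes p | yes q = yes (p ∷ q)
... | no ¬p | _ = no λ { (p ∷ _) → ¬p p }
... | yes _ | no ¬q = no λ { (_ ∷ q) → ¬q q }

allLists : ℕ → ℕ → List (List ℕ)
allLists zero    m = [] ∷ []
allLists (suc k) m = concatMap (λ xs → map (_∷ xs) (upTo (suc m))) (allLists k m)

Counted : ℕ → List ℕ → Set
Counted n xs = InPTI xs × AllGe3 xs × (sum xs ≡ n)

counted? : ∀ n xs → Dec (Counted n xs)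
counted? n xs = inPTI? xs ×-dec (allGe3? xs ×-dec (sum xs ℕ.≟ n))

-- number of λ ∈ 𝒫_{T_I} with smallest part ≥ 3, ♯(λ) = k, |λ| = n
-- (every part of such λ is ≤ n, so all of them occur exactly once in allLists k n)
gCoeff : ℕ → ℕ → ℕ
gCoeff k n = length (filter (counted? n) (allLists k n))

-- Formal power series in x, q with integer coefficients:
-- F k n = coefficient of x^k q^n.

FPS : Set
FPS = ℕ → ℕ → ℤ

G : FPS
G k n = + gCoeff k n

sumTo : ℕ → (ℕ → ℤ) → ℤ
sumTo zero    f = f 0
sumTo (suc k) f = sumTo k f ℤ.+ f (suc k)

_⊛_ : FPS → FPS → FPS
(F ⊛ H) k n = sumTo k λ i → sumTo n λ m → F i m ℤ.* H (k ∸ i) (n ∸ m)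

_⊕_ : FPS → FPS → FPS
(F ⊕ H) k n = F k n ℤ.+ H k n

-- F(x q^s): coefficient of x^k q^n is F k (n − s k) if s k ≤ n, else 0
subst-xq : ℕ → FPS → FPS
subst-xq s F k n with s ℕ.* k ≤? n
... | yes _ = F k (n ∸ s ℕ.* k)
... | no  _ = 0ℤ

-- polynomial given as list of monomials (c , a , b) meaning c·x^a q^b
Mono : Set
Mono = ℤ × ℕ × ℕ

poly : List Mono → FPS
poly []                  k n = 0ℤ
poly ((c , a , b) ∷ ms)  k n with a ℕ.≟ k | b ℕ.≟ n
... | yes _ | yes _ = c ℤ.+ poly ms k n
... | _     | _     = poly ms k n

m1 : ℤ
m1 = - (+ 1)

p0 p3 p6 p9 : FPS
p0 = poly ((+ 1 , 0 , 0) ∷ (+ 1 , 1 , 6) ∷ (+ 1 , 1 , 7) ∷ [])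
p3 = poly ( (m1 , 0 , 0)
          ∷ (m1 , 1 , 3) ∷ (m1 , 1 , 4) ∷ (m1 , 1 , 5) ∷ (m1 , 1 , 6) ∷ (m1 , 1 , 7)
          ∷ (m1 , 2 , 6) ∷ (m1 , 2 , 8) ∷ (- (+ 2) , 2 , 9) ∷ (- (+ 2) , 2 , 10)
          ∷ (m1 , 2 , 11) ∷ (m1 , 2 , 12)
          ∷ (m1 , 3 , 12) ∷ (m1 , 3 , 13) ∷ (m1 , 3 , 15) ∷ (m1 , 3 , 16) ∷ [])
p6 = poly ( (+ 1 , 3 , 16) ∷ (+ 1 , 3 , 17)
          ∷ (+ 1 , 4 , 20) ∷ (+ 1 , 4 , 21) ∷ (+ 1 , 4 , 22) ∷ (+ 1 , 4 , 23) ∷ (+ 1 , 4 , 24)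
          ∷ (+ 1 , 5 , 27) ∷ (+ 1 , 5 , 28) ∷ [])
p9 = poly ((+ 1 , 5 , 36) ∷ (+ 1 , 6 , 39) ∷ (+ 1 , 6 , 40) ∷ [])

LHS : FPS
LHS = (p0 ⊛ G) ⊕ ((p3 ⊛ subst-xq 3 G) ⊕ ((p6 ⊛ subst-xq 6 G) ⊕ (p9 ⊛ subst-xq 9 G)))

module Submission where

-- Partitions are built from the smallest part upwards.  Ext L q counts the partitions
-- that may be stacked on top of a part q (its first part ≥ L, which encodes the condition
-- λᵢ − λᵢ₊₂ ≥ 3 with the part below q), and Tail v counts those with smallest part ≥ v.
-- Splitting off the smallest part gives the two recurrences
--   (peel)    Tail v  = x q^v Ext v v + Tail (v + 1),
--   (unfold)  Ext L q = 1 + Σ_{w = q}^{q+2} [w allowed above q] x q^w Ext (q + 3) w + Tail (q + 3),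
-- and translating every part by 3 gives Tail (v + 3)(x) = Tail v (x q³), whence
-- G(x q^{3m}) = 1 + Tail (3m + 3).  The theorem thereby becomes a linear identity among
-- shifted series x^a q^b F with F ∈ {1, Tail v, Ext L q}: it is an explicit integer
-- combination of instances of (peel) and (unfold), organised through the relations for a
-- smallest part exactly v, v + 1, v + 2 (3 ∣ v), and checked by collecting like terms.

open import Defs
open import Data.Nat as ℕ using (ℕ; zero; suc; _+_; _*_; _∸_; _≤_; _<_; _≤?_; _<?_; _≟_; _≤ᵇ_; z≤n; s≤s; _%_)
import Data.Nat.Properties as ℕP
open import Data.Nat.DivMod using ([m+n]%n≡m%n)
open import Data.Nat.Tactic.RingSolver using (solve-∀)
open import Data.Nat.ListAction using (sum)
open import Data.Nat.ListAction.Properties using (sum-++)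
open import Data.Integer as ℤ using (ℤ; +_; -[1+_]; 0ℤ; 1ℤ; -1ℤ; _⊖_)
import Data.Integer.Properties as ℤP
import Data.Integer.Tactic.RingSolver as ℤSolver
open import Data.List using (List; []; _∷_; _++_; _∷ʳ_; map; concatMap; filter; length; upTo; applyUpTo)
open import Data.Product using (_×_; _,_; proj₁; proj₂)
open import Data.Product.Properties using (≡-dec)
open import Data.Bool using (Bool; true; false; T)
open import Data.Unit using (⊤; tt)
open import Data.Empty using (⊥-elim)
open import Relation.Nullary using (Dec; yes; no; ¬_)
open import Relation.Nullary.Decidable using (_×-dec_)
open import Relation.Binary.Definitions using (DecidableEquality)
open import Relation.Binary.PropositionalEquality
open import Algebra.Properties.CommutativeSemigroup ℕP.*-commutativeSemigroup using (x∙yz≈y∙xz)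

ind : ∀ {p} {P : Set p} → Dec P → ℕ
ind (yes _) = 1
ind (no _)  = 0

ind-yes : ∀ {p} {P : Set p} (d : Dec P) → P → ind d ≡ 1
ind-yes (yes _) _ = refl
ind-yes (no ¬p) p = ⊥-elim (¬p p)

ind-no : ∀ {p} {P : Set p} (d : Dec P) → ¬ P → ind d ≡ 0
ind-no (yes p) ¬p = ⊥-elim (¬p p)
ind-no (no _)  _  = refl

ind-⇔ : ∀ {p q} {P : Set p} {Q : Set q} (d : Dec P) (e : Dec Q) →
        (P → Q) → (Q → P) → ind d ≡ ind e
ind-⇔ (yes p) e f g = sym (ind-yes e (f p))
ind-⇔ (no ¬p) e f g = sym (ind-no e (λ q → ¬p (g q)))

ind-× : ∀ {p q} {P : Set p} {Q : Set q} (d : Dec P) (e : Dec Q) →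
        ind (d ×-dec e) ≡ ind d * ind e
ind-× (yes _) (yes _) = refl
ind-× (yes _) (no _)  = refl
ind-× (no _)  _       = refl

ind-≤-split : ∀ c w → ind (c ≤? w) ≡ ind (w ≟ c) + ind (suc c ≤? w)
ind-≤-split c w with c ≤? w | w ≟ c | suc c ≤? w
... | yes _   | yes refl | yes c<c  = ⊥-elim (ℕP.<-irrefl refl c<c)
... | yes _   | yes _    | no _     = refl
... | yes _   | no _     | yes _    = refl
... | yes c≤w | no w≢c   | no c≮w   = ⊥-elim (c≮w (ℕP.≤∧≢⇒< c≤w (λ e → w≢c (sym e))))
... | no c≰w  | yes refl | _        = ⊥-elim (c≰w ℕP.≤-refl)
... | no c≰w  | no _     | yes c<w  = ⊥-elim (c≰w (ℕP.<⇒≤ c<w))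
... | no _    | no _     | no _     = refl

Σ< : ℕ → (ℕ → ℕ) → ℕ
Σ< zero    f = 0
Σ< (suc n) f = f 0 + Σ< n (λ i → f (suc i))

Σ<-cong : ∀ n {f g : ℕ → ℕ} → (∀ i → i < n → f i ≡ g i) → Σ< n f ≡ Σ< n g
Σ<-cong zero    h = refl
Σ<-cong (suc n) h = cong₂ _+_ (h 0 (s≤s z≤n)) (Σ<-cong n (λ i i<n → h (suc i) (s≤s i<n)))

Σ<-+ : ∀ n (f g : ℕ → ℕ) → Σ< n (λ i → f i + g i) ≡ Σ< n f + Σ< n g
Σ<-+ zero    f g = refl
Σ<-+ (suc n) f g = trans (cong (λ z → f 0 + g 0 + z) (Σ<-+ n _ _)) (interchange (f 0) (g 0) _ _)
  where
  interchange : ∀ a b c d → (a + b) + (c + d) ≡ (a + c) + (b + d)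
  interchange = solve-∀

Σ<-*ˡ : ∀ n c (f : ℕ → ℕ) → Σ< n (λ i → c * f i) ≡ c * Σ< n f
Σ<-*ˡ zero    c f = sym (ℕP.*-zeroʳ c)
Σ<-*ˡ (suc n) c f = trans (cong (λ z → c * f 0 + z) (Σ<-*ˡ n c _)) (sym (ℕP.*-distribˡ-+ c (f 0) _))

Σ<-vanishing : ∀ n (f : ℕ → ℕ) → (∀ i → i < n → f i ≡ 0) → Σ< n f ≡ 0
Σ<-vanishing zero    f h = refl
Σ<-vanishing (suc n) f h = cong₂ _+_ (h 0 (s≤s z≤n)) (Σ<-vanishing n _ (λ i i<n → h (suc i) (s≤s i<n)))

Σ<-truncate : ∀ m M (f : ℕ → ℕ) → m ≤ M → (∀ i → m ≤ i → i < M → f i ≡ 0) → Σ< M f ≡ Σ< m f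
Σ<-truncate zero    M       f _         h = Σ<-vanishing M f (λ i i<M → h i z≤n i<M)
Σ<-truncate (suc m) (suc M) f (s≤s m≤M) h =
  cong (λ z → f 0 + z) (Σ<-truncate m M _ m≤M (λ i m≤i i<M → h (suc i) (s≤s m≤i) (s≤s i<M)))

Σ<-pad : ∀ m M (f : ℕ → ℕ) → m ≤ M → Σ< m f ≡ Σ< M (λ w → ind (w <? m) * f w)
Σ<-pad m M f m≤M = sym (trans
  (Σ<-truncate m M _ m≤M (λ i m≤i _ → cong (_* f i) (ind-no (i <? m) (ℕP.≤⇒≯ m≤i))))
  (Σ<-cong m (λ i i<m → trans (cong (_* f i) (ind-yes (i <? m) i<m)) (ℕP.+-identityʳ (f i)))))

Σ<-point : ∀ n c (h : ℕ → ℕ) → Σ< n (λ w → ind (w ≟ c) * h w) ≡ ind (c <? n) * h c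
Σ<-point zero    c       h = cong (_* h c) (sym (ind-no (c <? 0) (λ ())))
Σ<-point (suc n) zero    h =
  trans (cong₂ _+_ (cong (_* h 0) (ind-yes (0 ≟ 0) refl))
                   (Σ<-vanishing n _ (λ i _ → cong (_* h (suc i)) (ind-no (suc i ≟ 0) (λ ())))))
        (trans (ℕP.+-identityʳ _) (cong (_* h 0) (sym (ind-yes (0 <? suc n) (s≤s z≤n)))))
Σ<-point (suc n) (suc c) h =
  trans (cong₂ _+_ (cong (_* h 0) (ind-no (0 ≟ suc c) (λ ())))
          (trans (Σ<-cong n (λ i _ → cong (_* h (suc i))
                    (ind-⇔ (suc i ≟ suc c) (i ≟ c) ℕP.suc-injective (cong suc))))
                 (Σ<-point n c (λ i → h (suc i)))))
        (cong (_* h (suc c)) (ind-⇔ (c <? n) (suc c <? suc n) s≤s ℕP.≤-pred))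

Σ<-peel : ∀ m c (g : ℕ → ℕ) →
  Σ< m (λ w → ind (c ≤? w) * g w) ≡ ind (c <? m) * g c + Σ< m (λ w → ind (suc c ≤? w) * g w)
Σ<-peel m c g = begin
  Σ< m (λ w → ind (c ≤? w) * g w)
    ≡⟨ Σ<-cong m (λ w _ → trans (cong (_* g w) (ind-≤-split c w))
                                (ℕP.*-distribʳ-+ (g w) (ind (w ≟ c)) _)) ⟩
  Σ< m (λ w → ind (w ≟ c) * g w + ind (suc c ≤? w) * g w)
    ≡⟨ Σ<-+ m _ _ ⟩
  Σ< m (λ w → ind (w ≟ c) * g w) + Σ< m (λ w → ind (suc c ≤? w) * g w)
    ≡⟨ cong (_+ Σ< m (λ w → ind (suc c ≤? w) * g w)) (Σ<-point m c g) ⟩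
  ind (c <? m) * g c + Σ< m (λ w → ind (suc c ≤? w) * g w) ∎
  where open ≡-Reasoning

-- allowed L q w = 1 exactly when a part w may sit directly above the part q, where
-- L is the lower bound imposed by the part below q (the condition λᵢ − λᵢ₊₂ ≥ 3).
allowed : ℕ → ℕ → ℕ → ℕ
allowed L q w = ind (L ≤? w) * ind (pairOK? w q)

-- Ext L q k n counts the sequences of k parts with sum n which, listed from the
-- smallest up, may be stacked above a part q whose own lower neighbour forces the
-- first part to be ≥ L, so that every pair and triple condition of 𝒫_{T_I} holds.
Ext : ℕ → ℕ → ℕ → ℕ → ℕ
Ext L q zero    n = ind (n ≟ 0)
Ext L q (suc k) n = Σ< (suc n) (λ w → allowed L q w * Ext (3 + q) w k (n ∸ w))

-- Tail v k n counts the nonempty λ ∈ 𝒫_{T_I} with k parts, sum n and smallest part ≥ v: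
-- the smallest part w is followed by an extension above w with no extra lower bound.
Tail : ℕ → ℕ → ℕ → ℕ
Tail v zero    n = 0
Tail v (suc k) n = Σ< (suc n) (λ w → ind (v ≤? w) * Ext w w k (n ∸ w))

-- A part above q is at least q, so bounds L ≤ q are vacuous.
allowed-lower : ∀ {L q} w → L ≤ q → allowed L q w ≡ allowed q q w
allowed-lower {L} {q} w L≤q with pairOK? w q
... | yes p = cong (_* 1) (trans (ind-yes (L ≤? w) (ℕP.≤-trans L≤q (proj₁ p)))
                                 (sym (ind-yes (q ≤? w) (proj₁ p))))
... | no _  = trans (ℕP.*-zeroʳ (ind (L ≤? w))) (sym (ℕP.*-zeroʳ (ind (q ≤? w))))

allowed-above : ∀ L q w → allowed L q w ≡ ind (q ≤? w) * allowed L q w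
allowed-above L q w with q ≤? w | pairOK? w q
... | yes _  | _     = sym (ℕP.+-identityʳ _)
... | no q≰w | yes p = ⊥-elim (q≰w (proj₁ p))
... | no _   | no _  = ℕP.*-zeroʳ (ind (L ≤? w))

pair-far : ∀ w q → 3 + q ≤ w → PairOK w q
pair-far w q h = ℕP.≤-trans (ℕP.m≤n+m q 3) h , λ d → ⊥-elim (ℕP.<⇒≱ (s≤s (s≤s z≤n)) (ℕP.≤-trans gap d))
  where
  gap : 3 ≤ w ∸ q
  gap = subst (_≤ w ∸ q) (ℕP.m+n∸n≡m 3 q) (ℕP.∸-monoˡ-≤ q h)

allowed-far : ∀ {L q} w → L ≤ w → 3 + q ≤ w → allowed L q w ≡ 1
allowed-far {L} {q} w L≤w h = cong₂ _*_ (ind-yes (L ≤? w) L≤w) (ind-yes (pairOK? w q) (pair-far w q h))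

Ext-lower : ∀ L q k n → L ≤ q → Ext L q k n ≡ Ext q q k n
Ext-lower L q zero    n _   = refl
Ext-lower L q (suc k) n L≤q =
  Σ<-cong (suc n) (λ w _ → cong (_* Ext (3 + q) w k (n ∸ w)) (allowed-lower w L≤q))

Tail-peel : ∀ v k n → Tail v (suc k) n ≡ ind (v <? suc n) * Ext v v k (n ∸ v) + Tail (suc v) (suc k) n
Tail-peel v k n = Σ<-peel (suc n) v (λ w → Ext w w k (n ∸ w))

ExtTerm : ℕ → ℕ → ℕ → ℕ → ℕ → ℕ
ExtTerm L q k n w = allowed L q w * Ext (3 + q) w k (n ∸ w)

-- Ext L q = 1 + Σ_{w = q, q+1, q+2} allowed L q w · x q^w Ext (q+3) w + Tail (q + 3):
-- a first part w ≥ q + 3 is unconstrained by q, and then Ext (q + 3) w = Ext w w.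
Ext-unfold : ∀ L q k n → L ≤ 3 + q →
  Ext L q (suc k) n ≡ ind (q <? suc n) * ExtTerm L q k n q
                    + (ind (1 + q <? suc n) * ExtTerm L q k n (1 + q)
                    + (ind (2 + q <? suc n) * ExtTerm L q k n (2 + q)
                    + Tail (3 + q) (suc k) n))
Ext-unfold L q k n L≤ = begin
  Σ< (suc n) t
    ≡⟨ Σ<-cong (suc n) (λ w _ → above w) ⟩
  Σ< (suc n) (λ w → ind (q ≤? w) * t w)
    ≡⟨ Σ<-peel (suc n) q t ⟩
  step q + Σ< (suc n) (λ w → ind (1 + q ≤? w) * t w)
    ≡⟨ cong (λ z → step q + z) (Σ<-peel (suc n) (1 + q) t) ⟩
  step q + (step (1 + q) + Σ< (suc n) (λ w → ind (2 + q ≤? w) * t w))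
    ≡⟨ cong (λ z → step q + (step (1 + q) + z)) (Σ<-peel (suc n) (2 + q) t) ⟩
  step q + (step (1 + q) + (step (2 + q) + Σ< (suc n) (λ w → ind (3 + q ≤? w) * t w)))
    ≡⟨ cong (λ z → step q + (step (1 + q) + (step (2 + q) + z))) (Σ<-cong (suc n) (λ w _ → far w)) ⟩
  step q + (step (1 + q) + (step (2 + q) + Tail (3 + q) (suc k) n)) ∎
  where
  open ≡-Reasoning
  t : ℕ → ℕ
  t = ExtTerm L q k n
  step : ℕ → ℕ
  step w = ind (w <? suc n) * t w
  above : ∀ w → t w ≡ ind (q ≤? w) * t w
  above w = trans (cong (_* Ext (3 + q) w k (n ∸ w)) (allowed-above L q w))
                  (ℕP.*-assoc (ind (q ≤? w)) _ _)
  far : ∀ w → ind (3 + q ≤? w) * t w ≡ ind (3 + q ≤? w) * Ext w w k (n ∸ w)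
  far w with 3 + q ≤? w
  ... | no _  = refl
  ... | yes h = cong (_+ 0) (trans (cong₂ _*_ (allowed-far w (ℕP.≤-trans L≤ h) h)
                                              (Ext-lower (3 + q) w k (n ∸ w) h))
                                   (ℕP.*-identityˡ _))

-- Translating all parts by 3: the pair and triple conditions are invariant.
mod3-translate : ∀ a b → ((3 + a) + (3 + b)) % 3 ≡ (a + b) % 3
mod3-translate a b = trans (cong (_% 3) (regroup a b))
                           (trans ([m+n]%n≡m%n ((a + b) + 3) 3) ([m+n]%n≡m%n (a + b) 3))
  where
  regroup : ∀ a b → (3 + a) + (3 + b) ≡ ((a + b) + 3) + 3
  regroup = solve-∀

pair-translate : ∀ a b → PairOK (3 + a) (3 + b) → PairOK a b
pair-translate a b (b≤a , h) = ℕP.+-cancelˡ-≤ 3 _ _ b≤a , λ d → trans (sym (mod3-translate a b)) (h d)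

pair-translate⁻¹ : ∀ a b → PairOK a b → PairOK (3 + a) (3 + b)
pair-translate⁻¹ a b (b≤a , h) = ℕP.+-monoʳ-≤ 3 b≤a , λ d → trans (mod3-translate a b) (h d)

≤-translate : ∀ a b → ind (3 + a ≤? 3 + b) ≡ ind (a ≤? b)
≤-translate a b = ind-⇔ (3 + a ≤? 3 + b) (a ≤? b) (ℕP.+-cancelˡ-≤ 3 _ _) (ℕP.+-monoʳ-≤ 3)

allowed-translate : ∀ L q w → allowed (3 + L) (3 + q) (3 + w) ≡ allowed L q w
allowed-translate L q w =
  cong₂ _*_ (≤-translate L w) (ind-⇔ (pairOK? (3 + w) (3 + q)) (pairOK? w q) (pair-translate w q) (pair-translate⁻¹ w q))

join≤ : ∀ {n} a b → (a ≤ n) × (b ≤ n ∸ a) → a + b ≤ n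
join≤ a b (a≤n , b≤) = subst (a + b ≤_) (ℕP.m+[n∸m]≡n a≤n) (ℕP.+-monoʳ-≤ a b≤)

split≤ : ∀ {n} a b → a + b ≤ n → (a ≤ n) × (b ≤ n ∸ a)
split≤ {n} a b h = ℕP.≤-trans (ℕP.m≤m+n a b) h , subst (_≤ n ∸ a) (ℕP.m+n∸m≡n a b) (ℕP.∸-monoˡ-≤ a h)

-- Arithmetic of the translation: a smallest part 3 + w followed by k parts that need
-- 3k more units fits into n exactly when 3(k + 1) units fit and w fits into the rest.
budget : ∀ n k w → ind (3 + w <? suc n) * ind (3 * k ≤? n ∸ (3 + w))
                 ≡ ind (3 * suc k ≤? n) * ind (w <? suc (n ∸ 3 * suc k))
budget n k w = begin
  ind (3 + w <? suc n) * ind (3 * k ≤? n ∸ (3 + w))  ≡⟨ sym (ind-× (3 + w <? suc n) _) ⟩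
  ind ((3 + w <? suc n) ×-dec (3 * k ≤? n ∸ (3 + w)))  ≡⟨ ind-⇔ _ ((3 * suc k ≤? n) ×-dec (w <? suc m)) into outof ⟩
  ind ((3 * suc k ≤? n) ×-dec (w <? suc m))           ≡⟨ ind-× (3 * suc k ≤? n) (w <? suc m) ⟩
  ind (3 * suc k ≤? n) * ind (w <? suc m) ∎
  where
  open ≡-Reasoning
  m : ℕ
  m = n ∸ 3 * suc k
  regroup : ∀ k w → 3 * suc k + w ≡ (3 + w) + 3 * k
  regroup = solve-∀
  into : (3 + w < suc n) × (3 * k ≤ n ∸ (3 + w)) → (3 * suc k ≤ n) × (w < suc m)
  into (a , b) with split≤ (3 * suc k) w (subst (_≤ n) (sym (regroup k w)) (join≤ (3 + w) (3 * k) (ℕP.≤-pred a , b)))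
  ... | x , y = x , s≤s y
  outof : (3 * suc k ≤ n) × (w < suc m) → (3 + w < suc n) × (3 * k ≤ n ∸ (3 + w))
  outof (a , b) with split≤ (3 + w) (3 * k) (subst (_≤ n) (regroup k w) (join≤ (3 * suc k) w (a , ℕP.≤-pred b)))
  ... | x , y = s≤s x , y

remaining : ∀ n k w → n ∸ (3 + w) ∸ 3 * k ≡ n ∸ 3 * suc k ∸ w
remaining n k w = begin
  n ∸ (3 + w) ∸ 3 * k  ≡⟨ ℕP.∸-+-assoc n (3 + w) (3 * k) ⟩
  n ∸ (3 + w + 3 * k)  ≡⟨ cong (n ∸_) (regroup k w) ⟩
  n ∸ (3 * suc k + w)  ≡⟨ sym (ℕP.∸-+-assoc n (3 * suc k) w) ⟩
  n ∸ 3 * suc k ∸ w ∎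
  where
  open ≡-Reasoning
  regroup : ∀ k w → 3 + w + 3 * k ≡ 3 * suc k + w
  regroup = solve-∀

-- The sum over the smallest part of a translated count: parts below 3 contribute
-- nothing, and a part 3 + w contributes the untranslated count for w.
Σ<-translate : ∀ n k (F : ℕ → ℕ) (g : ℕ → ℕ → ℕ) → F 0 ≡ 0 → F 1 ≡ 0 → F 2 ≡ 0 →
  (∀ w → F (3 + w) ≡ ind (3 * k ≤? n ∸ (3 + w)) * g w (n ∸ (3 + w) ∸ 3 * k)) →
  Σ< (suc n) F ≡ ind (3 * suc k ≤? n) * Σ< (suc (n ∸ 3 * suc k)) (λ w → g w (n ∸ 3 * suc k ∸ w))
Σ<-translate n k F g F0 F1 F2 F3+ = begin
  Σ< (suc n) F
    ≡⟨ Σ<-pad (suc n) (3 + suc n) F (ℕP.m≤n+m (suc n) 3) ⟩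
  ind (0 <? suc n) * F 0 + (ind (1 <? suc n) * F 1 + (ind (2 <? suc n) * F 2 + Σ< (suc n) shifted))
    ≡⟨ cong₂ (λ a b → ind (0 <? suc n) * F 0 + (a + (b + Σ< (suc n) shifted)))
             (trans (cong (ind (1 <? suc n) *_) F1) (ℕP.*-zeroʳ (ind (1 <? suc n))))
             (trans (cong (ind (2 <? suc n) *_) F2) (ℕP.*-zeroʳ (ind (2 <? suc n)))) ⟩
  ind (0 <? suc n) * F 0 + Σ< (suc n) shifted
    ≡⟨ cong (λ a → ind (0 <? suc n) * a + Σ< (suc n) shifted) F0 ⟩
  Σ< (suc n) shifted
    ≡⟨ Σ<-cong (suc n) (λ w _ → reindex w) ⟩
  Σ< (suc n) (λ w → ind (3 * suc k ≤? n) * (ind (w <? suc m) * g w (m ∸ w)))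
    ≡⟨ Σ<-*ˡ (suc n) (ind (3 * suc k ≤? n)) (λ w → ind (w <? suc m) * g w (m ∸ w)) ⟩
  ind (3 * suc k ≤? n) * Σ< (suc n) (λ w → ind (w <? suc m) * g w (m ∸ w))
    ≡⟨ cong (ind (3 * suc k ≤? n) *_) (sym (Σ<-pad (suc m) (suc n) (λ w → g w (m ∸ w)) (s≤s (ℕP.m∸n≤m n (3 * suc k))))) ⟩
  ind (3 * suc k ≤? n) * Σ< (suc m) (λ w → g w (m ∸ w)) ∎
  where
  open ≡-Reasoning
  m : ℕ
  m = n ∸ 3 * suc k
  shifted : ℕ → ℕ
  shifted w = ind (3 + w <? suc n) * F (3 + w)
  reindex : ∀ w → shifted w ≡ ind (3 * suc k ≤? n) * (ind (w <? suc m) * g w (m ∸ w))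
  reindex w = begin
    ind (3 + w <? suc n) * F (3 + w)
      ≡⟨ cong (ind (3 + w <? suc n) *_) (F3+ w) ⟩
    ind (3 + w <? suc n) * (ind (3 * k ≤? n ∸ (3 + w)) * g w (n ∸ (3 + w) ∸ 3 * k))
      ≡⟨ sym (ℕP.*-assoc (ind (3 + w <? suc n)) _ _) ⟩
    ind (3 + w <? suc n) * ind (3 * k ≤? n ∸ (3 + w)) * g w (n ∸ (3 + w) ∸ 3 * k)
      ≡⟨ cong₂ _*_ (budget n k w) (cong (g w) (remaining n k w)) ⟩
    ind (3 * suc k ≤? n) * ind (w <? suc m) * g w (m ∸ w)
      ≡⟨ ℕP.*-assoc (ind (3 * suc k ≤? n)) _ _ ⟩
    ind (3 * suc k ≤? n) * (ind (w <? suc m) * g w (m ∸ w)) ∎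

-- Ext (L + 3) (q + 3) (x) = Ext L q (x q³): every part is translated by 3.
Ext-translate : ∀ L q k n → Ext (3 + L) (3 + q) k n ≡ ind (3 * k ≤? n) * Ext L q k (n ∸ 3 * k)
Ext-translate L q zero    n = sym (ℕP.+-identityʳ (ind (n ≟ 0)))
Ext-translate L q (suc k) n =
  Σ<-translate n k (λ w → allowed (3 + L) (3 + q) w * Ext (3 + (3 + q)) w k (n ∸ w))
    (λ w r → allowed L q w * Ext (3 + q) w k r) refl refl refl λ w → begin
    allowed (3 + L) (3 + q) (3 + w) * Ext (3 + (3 + q)) (3 + w) k (n ∸ (3 + w))
      ≡⟨ cong₂ _*_ (allowed-translate L q w) (Ext-translate (3 + q) w k (n ∸ (3 + w))) ⟩
    allowed L q w * (ind (3 * k ≤? n ∸ (3 + w)) * Ext (3 + q) w k (n ∸ (3 + w) ∸ 3 * k))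
      ≡⟨ x∙yz≈y∙xz (allowed L q w) (ind (3 * k ≤? n ∸ (3 + w))) _ ⟩
    ind (3 * k ≤? n ∸ (3 + w)) * (allowed L q w * Ext (3 + q) w k (n ∸ (3 + w) ∸ 3 * k)) ∎
  where open ≡-Reasoning

Tail-translate : ∀ v k n → Tail (3 + v) k n ≡ ind (3 * k ≤? n) * Tail v k (n ∸ 3 * k)
Tail-translate v zero    n = sym (ℕP.*-zeroʳ (ind (0 ≤? n)))
Tail-translate v (suc k) n =
  Σ<-translate n k (λ w → ind (3 + v ≤? w) * Ext w w k (n ∸ w))
    (λ w r → ind (v ≤? w) * Ext w w k r) refl refl refl λ w → begin
    ind (3 + v ≤? 3 + w) * Ext (3 + w) (3 + w) k (n ∸ (3 + w))
      ≡⟨ cong₂ _*_ (≤-translate v w) (Ext-translate w w k (n ∸ (3 + w))) ⟩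
    ind (v ≤? w) * (ind (3 * k ≤? n ∸ (3 + w)) * Ext w w k (n ∸ (3 + w) ∸ 3 * k))
      ≡⟨ x∙yz≈y∙xz (ind (v ≤? w)) (ind (3 * k ≤? n ∸ (3 + w))) _ ⟩
    ind (3 * k ≤? n ∸ (3 + w)) * (ind (v ≤? w) * Ext w w k (n ∸ (3 + w) ∸ 3 * k)) ∎
  where open ≡-Reasoning

Tail-translate-by : ∀ m v k n → Tail (m * 3 + v) k n ≡ ind (m * 3 * k ≤? n) * Tail v k (n ∸ m * 3 * k)
Tail-translate-by zero    v k n = sym (ℕP.+-identityʳ (Tail v k n))
Tail-translate-by (suc m) v k n = begin
  Tail (3 + m * 3 + v) k n
    ≡⟨ cong (λ u → Tail u k n) (ℕP.+-assoc 3 (m * 3) v) ⟩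
  Tail (3 + (m * 3 + v)) k n
    ≡⟨ Tail-translate (m * 3 + v) k n ⟩
  ind (3 * k ≤? n) * Tail (m * 3 + v) k (n ∸ 3 * k)
    ≡⟨ cong (ind (3 * k ≤? n) *_) (Tail-translate-by m v k (n ∸ 3 * k)) ⟩
  ind (3 * k ≤? n) * (ind (m * 3 * k ≤? n ∸ 3 * k) * Tail v k (n ∸ 3 * k ∸ m * 3 * k))
    ≡⟨ combine (3 * k) (m * 3 * k) ⟩
  ind (3 * k + m * 3 * k ≤? n) * Tail v k (n ∸ (3 * k + m * 3 * k))
    ≡⟨ cong (λ u → ind (u ≤? n) * Tail v k (n ∸ u)) (sym (ℕP.*-distribʳ-+ k 3 (m * 3))) ⟩
  ind ((3 + m * 3) * k ≤? n) * Tail v k (n ∸ (3 + m * 3) * k) ∎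
  where
  open ≡-Reasoning
  combine : ∀ a b → ind (a ≤? n) * (ind (b ≤? n ∸ a) * Tail v k (n ∸ a ∸ b))
                  ≡ ind (a + b ≤? n) * Tail v k (n ∸ (a + b))
  combine a b = trans (sym (ℕP.*-assoc (ind (a ≤? n)) _ _))
    (cong₂ _*_ (trans (sym (ind-× (a ≤? n) (b ≤? n ∸ a)))
                      (ind-⇔ _ (a + b ≤? n) (join≤ a b) (split≤ a b)))
               (cong (Tail v k) (ℕP.∸-+-assoc n a b)))

-- Admissible L q ys: the list ys (largest part first) may be stacked above a part q,
-- with smallest part ≥ L; this is the predicate counted by Ext L q.
Admissible : ℕ → ℕ → List ℕ → Set
Admissible L q []              = ⊤
Admissible L q (a ∷ [])        = L ≤ a × PairOK a q
Admissible L q (a ∷ b ∷ [])    = PairOK a b × (TripleOK a q × Admissible L q (b ∷ []))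
Admissible L q (a ∷ b ∷ c ∷ r) = PairOK a b × (TripleOK a c × Admissible L q (b ∷ c ∷ r))

admissible? : ∀ L q ys → Dec (Admissible L q ys)
admissible? L q []              = yes tt
admissible? L q (a ∷ [])        = (L ≤? a) ×-dec pairOK? a q
admissible? L q (a ∷ b ∷ [])    = pairOK? a b ×-dec ((3 + q ≤? a) ×-dec admissible? L q (b ∷ []))
admissible? L q (a ∷ b ∷ c ∷ r) = pairOK? a b ×-dec ((3 + c ≤? a) ×-dec admissible? L q (b ∷ c ∷ r))

admissible-snoc : ∀ ys b L q → Admissible L q (ys ∷ʳ b) → (L ≤ b × PairOK b q) × Admissible (3 + q) b ys
admissible-snoc []                 b L q g = g , tt
admissible-snoc (a ∷ [])           b L q (p , (t , g)) = g , (t , p)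
admissible-snoc (a ∷ a' ∷ [])      b L q (p , (t , (p' , (t' , g)))) = g , (p , (t , (t' , p')))
admissible-snoc (a ∷ a' ∷ a'' ∷ r) b L q (p , (t , g)) with admissible-snoc (a' ∷ a'' ∷ r) b L q g
... | first , rest = first , (p , (t , rest))

admissible-snoc⁻¹ : ∀ ys b L q → (L ≤ b × PairOK b q) × Admissible (3 + q) b ys → Admissible L q (ys ∷ʳ b)
admissible-snoc⁻¹ []                 b L q (g , _) = g
admissible-snoc⁻¹ (a ∷ [])           b L q (g , (t , p)) = p , (t , g)
admissible-snoc⁻¹ (a ∷ a' ∷ [])      b L q (g , (p , (t , (t' , p')))) = p , (t , (p' , (t' , g)))
admissible-snoc⁻¹ (a ∷ a' ∷ a'' ∷ r) b L q (first , (p , (t , rest))) =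
  p , (t , admissible-snoc⁻¹ (a' ∷ a'' ∷ r) b L q (first , rest))

admissible-head : ∀ a r L q → Admissible L q (a ∷ r) → L ≤ a
admissible-head a []          L q (h , _)           = h
admissible-head a (b ∷ [])    L q (p , (_ , (h , _))) = ℕP.≤-trans h (proj₁ p)
admissible-head a (b ∷ c ∷ r) L q (p , (_ , g))     = ℕP.≤-trans (admissible-head b (c ∷ r) L q g) (proj₁ p)

positive : ∀ {a} → 3 ≤ a → 1 ≤ a
positive = ℕP.≤-trans (s≤s z≤n)

-- The partitions counted by G are exactly the lists admissible above a phantom part 0
-- with lower bound 3.
admissible-G : ∀ xs → InPTI xs → AllGe3 xs → Admissible 3 0 xs
admissible-G []              nil                _          = tt
admissible-G (a ∷ [])        (one _)            (h ∷ _)    = h , pair-far a 0 h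
admissible-G (a ∷ b ∷ [])    (two _ _ p)        (h ∷ h' ∷ _) = p , (h , (h' , pair-far b 0 h'))
admissible-G (a ∷ b ∷ c ∷ r) (more _ p t rest)  (_ ∷ hs)   = p , (t , admissible-G (b ∷ c ∷ r) rest hs)

admissible-G⁻¹ : ∀ xs → Admissible 3 0 xs → InPTI xs × AllGe3 xs
admissible-G⁻¹ []              _ = nil , []
admissible-G⁻¹ (a ∷ [])        g@(h , _) = one (positive h) , (h ∷ [])
admissible-G⁻¹ (a ∷ b ∷ [])    g@(p , (_ , (h , _))) =
  two (positive (admissible-head a (b ∷ []) 3 0 g)) (positive h) p , (admissible-head a (b ∷ []) 3 0 g ∷ h ∷ [])
admissible-G⁻¹ (a ∷ b ∷ c ∷ r) g@(p , (t , rest)) with admissible-G⁻¹ (b ∷ c ∷ r) rest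
... | inPTI , ge3 = more (positive (admissible-head a (b ∷ c ∷ r) 3 0 g)) p t inPTI
                  , (admissible-head a (b ∷ c ∷ r) 3 0 g ∷ ge3)

sumOver : ∀ {A : Set} → List A → (A → ℕ) → ℕ
sumOver []       f = 0
sumOver (x ∷ xs) f = f x + sumOver xs f

sumOver-cong : ∀ {A : Set} (xs : List A) {f g : A → ℕ} → (∀ x → f x ≡ g x) → sumOver xs f ≡ sumOver xs g
sumOver-cong []       h = refl
sumOver-cong (x ∷ xs) h = cong₂ _+_ (h x) (sumOver-cong xs h)

sumOver-++ : ∀ {A : Set} (xs ys : List A) (f : A → ℕ) → sumOver (xs ++ ys) f ≡ sumOver xs f + sumOver ys f
sumOver-++ []       ys f = refl
sumOver-++ (x ∷ xs) ys f = trans (cong (λ z → f x + z) (sumOver-++ xs ys f)) (sym (ℕP.+-assoc (f x) _ _))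

sumOver-concatMap : ∀ {A B : Set} (g : A → List B) (xs : List A) (f : B → ℕ) →
  sumOver (concatMap g xs) f ≡ sumOver xs (λ x → sumOver (g x) f)
sumOver-concatMap g []       f = refl
sumOver-concatMap g (x ∷ xs) f =
  trans (sumOver-++ (g x) (concatMap g xs) f) (cong (λ z → sumOver (g x) f + z) (sumOver-concatMap g xs f))

sumOver-map : ∀ {A B : Set} (h : A → B) (xs : List A) (f : B → ℕ) → sumOver (map h xs) f ≡ sumOver xs (λ x → f (h x))
sumOver-map h []       f = refl
sumOver-map h (x ∷ xs) f = cong (λ z → f (h x) + z) (sumOver-map h xs f)

sumOver-applyUpTo : ∀ n (h : ℕ → ℕ) (f : ℕ → ℕ) → sumOver (applyUpTo h n) f ≡ Σ< n (λ i → f (h i))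
sumOver-applyUpTo zero    h f = refl
sumOver-applyUpTo (suc n) h f = cong (λ z → f (h 0) + z) (sumOver-applyUpTo n (λ i → h (suc i)) f)

sumOver-*ˡ : ∀ {A : Set} (xs : List A) c (f : A → ℕ) → sumOver xs (λ x → c * f x) ≡ c * sumOver xs f
sumOver-*ˡ []       c f = sym (ℕP.*-zeroʳ c)
sumOver-*ˡ (x ∷ xs) c f = trans (cong (λ z → c * f x + z) (sumOver-*ˡ xs c f)) (sym (ℕP.*-distribˡ-+ c (f x) _))

length-filter : ∀ {A : Set} {P : A → Set} (P? : ∀ x → Dec (P x)) (xs : List A) →
  length (filter P? xs) ≡ sumOver xs (λ x → ind (P? x))
length-filter P? []       = refl
length-filter P? (x ∷ xs) with P? x
... | yes _ = cong suc (length-filter P? xs)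
... | no _  = length-filter P? xs

sumOver-allLists : ∀ k m (f : List ℕ → ℕ) →
  sumOver (allLists (suc k) m) f ≡ sumOver (allLists k m) (λ xs → Σ< (suc m) (λ a → f (a ∷ xs)))
sumOver-allLists k m f =
  trans (sumOver-concatMap (λ xs → map (_∷ xs) (upTo (suc m))) (allLists k m) f)
        (sumOver-cong (allLists k m) (λ xs → trans (sumOver-map (_∷ xs) (upTo (suc m)) f)
                                                  (sumOver-applyUpTo (suc m) (λ i → i) (λ a → f (a ∷ xs)))))

sumOver-allLists-snoc : ∀ k m (f : List ℕ → ℕ) →
  sumOver (allLists (suc k) m) f ≡ Σ< (suc m) (λ b → sumOver (allLists k m) (λ ys → f (ys ∷ʳ b)))
sumOver-allLists-snoc zero    m f =
  trans (sumOver-allLists zero m f)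
        (trans (ℕP.+-identityʳ _) (Σ<-cong (suc m) (λ b _ → sym (ℕP.+-identityʳ (f (b ∷ []))))))
sumOver-allLists-snoc (suc k) m f =
  trans (sumOver-allLists (suc k) m f)
    (trans (sumOver-allLists-snoc k m (λ xs → Σ< (suc m) (λ a → f (a ∷ xs))))
           (Σ<-cong (suc m) (λ b _ → sym (sumOver-allLists k m (λ zs → f (zs ∷ʳ b))))))

Fits : ℕ → ℕ → ℕ → List ℕ → Set
Fits L q n ys = Admissible L q ys × sum ys ≡ n

fits? : ∀ L q n ys → Dec (Fits L q n ys)
fits? L q n ys = admissible? L q ys ×-dec (sum ys ≟ n)

fits-snoc : ∀ ys b L q n →
  ind (fits? L q n (ys ∷ʳ b)) ≡ allowed L q b * (ind (b ≤? n) * ind (fits? (3 + q) b (n ∸ b) ys))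
fits-snoc ys b L q n = begin
  ind (fits? L q n (ys ∷ʳ b))
    ≡⟨ ind-⇔ (fits? L q n (ys ∷ʳ b)) ((L ≤? b ×-dec pairOK? b q) ×-dec ((b ≤? n) ×-dec fits? (3 + q) b (n ∸ b) ys)) into outof ⟩
  ind ((L ≤? b ×-dec pairOK? b q) ×-dec ((b ≤? n) ×-dec fits? (3 + q) b (n ∸ b) ys))
    ≡⟨ ind-× (L ≤? b ×-dec pairOK? b q) _ ⟩
  ind (L ≤? b ×-dec pairOK? b q) * ind ((b ≤? n) ×-dec fits? (3 + q) b (n ∸ b) ys)
    ≡⟨ cong₂ _*_ (ind-× (L ≤? b) (pairOK? b q)) (ind-× (b ≤? n) _) ⟩
  allowed L q b * (ind (b ≤? n) * ind (fits? (3 + q) b (n ∸ b) ys)) ∎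
  where
  open ≡-Reasoning
  sum-snoc : sum (ys ∷ʳ b) ≡ sum ys + b
  sum-snoc = trans (sum-++ ys (b ∷ [])) (cong (λ z → sum ys + z) (ℕP.+-identityʳ b))
  into : Fits L q n (ys ∷ʳ b) → (L ≤ b × PairOK b q) × (b ≤ n × Fits (3 + q) b (n ∸ b) ys)
  into (g , s) with admissible-snoc ys b L q g
  ... | first , rest = first , (subst (b ≤_) s (subst (b ≤_) (sym sum-snoc) (ℕP.m≤n+m b (sum ys))) ,
                                (rest , sym (trans (cong (_∸ b) (trans (sym s) sum-snoc)) (ℕP.m+n∸n≡m (sum ys) b))))
  outof : (L ≤ b × PairOK b q) × (b ≤ n × Fits (3 + q) b (n ∸ b) ys) → Fits L q n (ys ∷ʳ b)
  outof (first , (b≤n , (rest , s))) =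
    admissible-snoc⁻¹ ys b L q (first , rest) , trans sum-snoc (trans (cong (_+ b) s) (ℕP.m∸n+n≡m b≤n))

Ext-counts : ∀ k m n L q → n ≤ m → sumOver (allLists k m) (λ ys → ind (fits? L q n ys)) ≡ Ext L q k n
Ext-counts zero    m n L q _   = trans (ℕP.+-identityʳ _) (ind-⇔ (fits? L q n []) (n ≟ 0) (λ (_ , e) → sym e) (λ e → tt , sym e))
Ext-counts (suc k) m n L q n≤m = begin
  sumOver (allLists (suc k) m) (λ ys → ind (fits? L q n ys))
    ≡⟨ sumOver-allLists-snoc k m (λ ys → ind (fits? L q n ys)) ⟩
  Σ< (suc m) (λ b → sumOver (allLists k m) (λ ys → ind (fits? L q n (ys ∷ʳ b))))
    ≡⟨ Σ<-cong (suc m) (λ b _ → lastPart b) ⟩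
  Σ< (suc m) (λ b → ind (b <? suc n) * (allowed L q b * Ext (3 + q) b k (n ∸ b)))
    ≡⟨ sym (Σ<-pad (suc n) (suc m) (λ b → allowed L q b * Ext (3 + q) b k (n ∸ b)) (s≤s n≤m)) ⟩
  Ext L q (suc k) n ∎
  where
  open ≡-Reasoning
  lastPart : ∀ b → sumOver (allLists k m) (λ ys → ind (fits? L q n (ys ∷ʳ b)))
                 ≡ ind (b <? suc n) * (allowed L q b * Ext (3 + q) b k (n ∸ b))
  lastPart b = begin
    sumOver (allLists k m) (λ ys → ind (fits? L q n (ys ∷ʳ b)))
      ≡⟨ sumOver-cong (allLists k m) (λ ys → fits-snoc ys b L q n) ⟩
    sumOver (allLists k m) (λ ys → allowed L q b * (ind (b ≤? n) * ind (fits? (3 + q) b (n ∸ b) ys)))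
      ≡⟨ sumOver-*ˡ (allLists k m) (allowed L q b) _ ⟩
    allowed L q b * sumOver (allLists k m) (λ ys → ind (b ≤? n) * ind (fits? (3 + q) b (n ∸ b) ys))
      ≡⟨ cong (allowed L q b *_) (sumOver-*ˡ (allLists k m) (ind (b ≤? n)) _) ⟩
    allowed L q b * (ind (b ≤? n) * sumOver (allLists k m) (λ ys → ind (fits? (3 + q) b (n ∸ b) ys)))
      ≡⟨ cong (λ z → allowed L q b * (ind (b ≤? n) * z))
              (Ext-counts k m (n ∸ b) (3 + q) b (ℕP.≤-trans (ℕP.m∸n≤m n b) n≤m)) ⟩
    allowed L q b * (ind (b ≤? n) * Ext (3 + q) b k (n ∸ b))
      ≡⟨ x∙yz≈y∙xz (allowed L q b) (ind (b ≤? n)) _ ⟩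
    ind (b ≤? n) * (allowed L q b * Ext (3 + q) b k (n ∸ b))
      ≡⟨ cong (_* (allowed L q b * Ext (3 + q) b k (n ∸ b))) (ind-⇔ (b ≤? n) (b <? suc n) s≤s ℕP.≤-pred) ⟩
    ind (b <? suc n) * (allowed L q b * Ext (3 + q) b k (n ∸ b)) ∎

unitCoeff : ℕ → ℕ → ℕ
unitCoeff zero    n = ind (n ≟ 0)
unitCoeff (suc k) n = 0

gCoeff-split : ∀ k n → gCoeff k n ≡ unitCoeff k n + Tail 3 k n
gCoeff-split k n = begin
  gCoeff k n
    ≡⟨ length-filter (counted? n) (allLists k n) ⟩
  sumOver (allLists k n) (λ xs → ind (counted? n xs))
    ≡⟨ sumOver-cong (allLists k n) (λ xs → ind-⇔ (counted? n xs) (fits? 3 0 n xs)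
         (λ (i , a , s) → admissible-G xs i a , s)
         (λ (g , s) → proj₁ (admissible-G⁻¹ xs g) , proj₂ (admissible-G⁻¹ xs g) , s)) ⟩
  sumOver (allLists k n) (λ xs → ind (fits? 3 0 n xs))
    ≡⟨ Ext-counts k n n 3 0 ℕP.≤-refl ⟩
  Ext 3 0 k n
    ≡⟨ Ext-above-0 k ⟩
  unitCoeff k n + Tail 3 k n ∎
  where
  open ≡-Reasoning
  Ext-above-0 : ∀ k → Ext 3 0 k n ≡ unitCoeff k n + Tail 3 k n
  Ext-above-0 zero    = sym (ℕP.+-identityʳ _)
  Ext-above-0 (suc k) = Σ<-cong (suc n) first
    where
    first : ∀ w → w < suc n → allowed 3 0 w * Ext 3 w k (n ∸ w) ≡ ind (3 ≤? w) * Ext w w k (n ∸ w)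
    first w _ = trans (cong (_* Ext 3 w k (n ∸ w)) allowed-above-0) bound-irrelevant
      where
      allowed-above-0 : allowed 3 0 w ≡ ind (3 ≤? w)
      allowed-above-0 with 3 ≤? w
      ... | yes h = trans (ℕP.+-identityʳ _) (ind-yes (pairOK? w 0) (pair-far w 0 h))
      ... | no _  = refl
      bound-irrelevant : ind (3 ≤? w) * Ext 3 w k (n ∸ w) ≡ ind (3 ≤? w) * Ext w w k (n ∸ w)
      bound-irrelevant with 3 ≤? w
      ... | yes h = cong (1 *_) (Ext-lower 3 w k (n ∸ w) h)
      ... | no _  = refl

-- A series extended by zero to integer exponents.  Since K ⊖ a is negative exactly
-- when a > K, the coefficient of x^K q^N in x^a q^b F is  F ⟪ K ⊖ a , N ⊖ b ⟫.
_⟪_,_⟫ : FPS → ℤ → ℤ → ℤ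
F ⟪ + k      , + n      ⟫ = F k n
F ⟪ + k      , -[1+ n ] ⟫ = 0ℤ
F ⟪ -[1+ k ] , n        ⟫ = 0ℤ

series : (ℕ → ℕ → ℕ) → FPS
series c k n = + c k n

unit : FPS
unit = series unitCoeff

lower-q : ∀ (c : ℕ → ℕ → ℕ) k n m → series c ⟪ + k , + n ℤ.- + m ⟫ ≡ + (ind (m <? suc n) * c k (n ∸ m))
lower-q c k n m = trans (cong (λ y → series c ⟪ + k , y ⟫) (ℤP.m-n≡m⊖n n m)) (by-cases (m ≤? n))
  where
  by-cases : Dec (m ≤ n) → series c ⟪ + k , n ⊖ m ⟫ ≡ + (ind (m <? suc n) * c k (n ∸ m))
  by-cases (yes m≤n) =
    trans (cong (λ y → series c ⟪ + k , y ⟫) (ℤP.⊖-≥ m≤n))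
          (cong +_ (trans (sym (ℕP.+-identityʳ _)) (cong (_* c k (n ∸ m)) (sym (ind-yes (m <? suc n) (s≤s m≤n))))))
  by-cases (no m≰n) =
    trans (cong (λ y → series c ⟪ + k , y ⟫) (ℤP.⊖-< (ℕP.≰⇒> m≰n)))
          (trans (negative (ℕP.m<n⇒0<n∸m (ℕP.≰⇒> m≰n)))
                 (cong +_ (cong (_* c k (n ∸ m)) (sym (ind-no (m <? suc n) (λ h → m≰n (ℕP.≤-pred h)))))))
    where
    negative : ∀ {r} → 0 < r → series c ⟪ + k , ℤ.- (+ r) ⟫ ≡ 0ℤ
    negative {suc r} _ = refl

⊖-step : ∀ m n o → m ⊖ (o + n) ≡ (m ⊖ n) ℤ.- + o
⊖-step m n o = begin
  m ⊖ (o + n)                    ≡⟨ sym (ℤP.m-n≡m⊖n m (o + n)) ⟩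
  + m ℤ.- + (o + n)              ≡⟨ cong (λ z → + m ℤ.- z) (ℤP.pos-+ o n) ⟩
  + m ℤ.- (+ o ℤ.+ + n)          ≡⟨ regroup (+ m) (+ o) (+ n) ⟩
  (+ m ℤ.- + n) ℤ.- + o          ≡⟨ cong (ℤ._- + o) (ℤP.m-n≡m⊖n m n) ⟩
  (m ⊖ n) ℤ.- + o ∎
  where
  open ≡-Reasoning
  regroup : ∀ x y z → x ℤ.- (y ℤ.+ z) ≡ (x ℤ.- z) ℤ.- y
  regroup = ℤSolver.solve-∀

lower-q-negative : ∀ (F : FPS) k n m → F ⟪ + k , -[1+ n ] ℤ.- + m ⟫ ≡ 0ℤ
lower-q-negative F k n zero    = refl
lower-q-negative F k n (suc m) = refl

Tail-peelℤ : ∀ v x y → series (Tail v) ⟪ x , y ⟫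
                      ≡ series (Ext v v) ⟪ x ℤ.- 1ℤ , y ℤ.- + v ⟫ ℤ.+ series (Tail (suc v)) ⟪ x , y ⟫
Tail-peelℤ v       -[1+ k ]  y        = refl
Tail-peelℤ v       (+ zero)  (+ n)    = refl
Tail-peelℤ v       (+ zero)  -[1+ n ] = refl
Tail-peelℤ zero    (+ suc k) -[1+ n ] = refl
Tail-peelℤ (suc v) (+ suc k) -[1+ n ] = refl
Tail-peelℤ v       (+ suc k) (+ n)    = begin
  + Tail v (suc k) n
    ≡⟨ cong +_ (Tail-peel v k n) ⟩
  + (ind (v <? suc n) * Ext v v k (n ∸ v) ℕ.+ Tail (suc v) (suc k) n)
    ≡⟨ ℤP.pos-+ (ind (v <? suc n) * Ext v v k (n ∸ v)) _ ⟩
  + (ind (v <? suc n) * Ext v v k (n ∸ v)) ℤ.+ + Tail (suc v) (suc k) n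
    ≡⟨ cong (ℤ._+ + Tail (suc v) (suc k) n) (sym (lower-q (Ext v v) k n v)) ⟩
  series (Ext v v) ⟪ + k , + n ℤ.- + v ⟫ ℤ.+ + Tail (suc v) (suc k) n ∎
  where open ≡-Reasoning

placed : ℕ → ℕ → ℕ → ℤ → ℤ → ℤ
placed L q w x y = + allowed L q w ℤ.* series (Ext (3 + q) w) ⟪ x ℤ.- 1ℤ , y ℤ.- + w ⟫

placed-vanishes : ∀ L q w x y → series (Ext (3 + q) w) ⟪ x ℤ.- 1ℤ , y ℤ.- + w ⟫ ≡ 0ℤ → placed L q w x y ≡ 0ℤ
placed-vanishes L q w x y h = trans (cong (+ allowed L q w ℤ.*_) h) (ℤP.*-zeroʳ (+ allowed L q w))

placed-≡ : ∀ L q w k n → + (ind (w <? suc n) * ExtTerm L q k n w) ≡ placed L q w (+ suc k) (+ n)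
placed-≡ L q w k n = begin
  + (ind (w <? suc n) * (allowed L q w * Ext (3 + q) w k (n ∸ w)))
    ≡⟨ cong +_ (x∙yz≈y∙xz (ind (w <? suc n)) (allowed L q w) _) ⟩
  + (allowed L q w * (ind (w <? suc n) * Ext (3 + q) w k (n ∸ w)))
    ≡⟨ ℤP.pos-* (allowed L q w) _ ⟩
  + allowed L q w ℤ.* + (ind (w <? suc n) * Ext (3 + q) w k (n ∸ w))
    ≡⟨ cong (+ allowed L q w ℤ.*_) (sym (lower-q (Ext (3 + q) w) k n w)) ⟩
  placed L q w (+ suc k) (+ n) ∎
  where open ≡-Reasoning

-- Outside the generic range only the constant term of the unfolding survives.
others-vanish : ∀ {a b c d t} → b ≡ 0ℤ → c ≡ 0ℤ → d ≡ 0ℤ → t ≡ 0ℤ → a ℤ.+ (b ℤ.+ (c ℤ.+ (d ℤ.+ t))) ≡ a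
others-vanish refl refl refl refl = ℤP.+-identityʳ _

Ext-unfoldℤ : ∀ L q → L ≤ 3 + q → ∀ x y →
  series (Ext L q) ⟪ x , y ⟫ ≡ unit ⟪ x , y ⟫ ℤ.+ (placed L q q x y ℤ.+ (placed L q (1 + q) x y
                                ℤ.+ (placed L q (2 + q) x y ℤ.+ series (Tail (3 + q)) ⟪ x , y ⟫)))
Ext-unfoldℤ L q L≤ (+ suc k) (+ n) = begin
  + Ext L q (suc k) n
    ≡⟨ cong +_ (Ext-unfold L q k n L≤) ⟩
  + (step q ℕ.+ (step (1 + q) ℕ.+ (step (2 + q) ℕ.+ Tail (3 + q) (suc k) n)))
    ≡⟨ ℤP.pos-+ (step q) _ ⟩
  + step q ℤ.+ + (step (1 + q) ℕ.+ (step (2 + q) ℕ.+ Tail (3 + q) (suc k) n))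
    ≡⟨ cong (λ z → (+ step q) ℤ.+ z) (ℤP.pos-+ (step (1 + q)) _) ⟩
  + step q ℤ.+ (+ step (1 + q) ℤ.+ + (step (2 + q) ℕ.+ Tail (3 + q) (suc k) n))
    ≡⟨ cong (λ z → + step q ℤ.+ (+ step (1 + q) ℤ.+ z)) (ℤP.pos-+ (step (2 + q)) _) ⟩
  + step q ℤ.+ (+ step (1 + q) ℤ.+ (+ step (2 + q) ℤ.+ + Tail (3 + q) (suc k) n))
    ≡⟨ cong₂ (λ a z → a ℤ.+ z) (placed-≡ L q q k n)
         (cong₂ (λ b z → b ℤ.+ z) (placed-≡ L q (1 + q) k n)
           (cong (ℤ._+ + Tail (3 + q) (suc k) n) (placed-≡ L q (2 + q) k n))) ⟩
  placed L q q x y ℤ.+ (placed L q (1 + q) x y ℤ.+ (placed L q (2 + q) x y ℤ.+ + Tail (3 + q) (suc k) n))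
    ≡⟨ sym (ℤP.+-identityˡ _) ⟩
  unit ⟪ x , y ⟫ ℤ.+ (placed L q q x y ℤ.+ (placed L q (1 + q) x y
     ℤ.+ (placed L q (2 + q) x y ℤ.+ series (Tail (3 + q)) ⟪ x , y ⟫))) ∎
  where
  open ≡-Reasoning
  x y : ℤ
  x = + suc k
  y = + n
  step : ℕ → ℕ
  step w = ind (w <? suc n) * ExtTerm L q k n w
Ext-unfoldℤ L q _ -[1+ k ] y = sym (others-vanish (out-of-range q) (out-of-range (1 + q)) (out-of-range (2 + q)) refl)
  where
  out-of-range : ∀ w → placed L q w -[1+ k ] y ≡ 0ℤ
  out-of-range w = placed-vanishes L q w -[1+ k ] y refl
Ext-unfoldℤ L q _ (+ zero) (+ n) = sym (others-vanish (out-of-range q) (out-of-range (1 + q)) (out-of-range (2 + q)) refl)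
  where
  out-of-range : ∀ w → placed L q w (+ zero) (+ n) ≡ 0ℤ
  out-of-range w = placed-vanishes L q w (+ zero) (+ n) refl
Ext-unfoldℤ L q _ (+ zero) -[1+ n ] = sym (others-vanish (out-of-range q) (out-of-range (1 + q)) (out-of-range (2 + q)) refl)
  where
  out-of-range : ∀ w → placed L q w (+ zero) -[1+ n ] ≡ 0ℤ
  out-of-range w = placed-vanishes L q w (+ zero) -[1+ n ] refl
Ext-unfoldℤ L q _ (+ suc k) -[1+ n ] = sym (others-vanish (out-of-range q) (out-of-range (1 + q)) (out-of-range (2 + q)) refl)
  where
  out-of-range : ∀ w → placed L q w (+ suc k) -[1+ n ] ≡ 0ℤ
  out-of-range w = placed-vanishes L q w (+ suc k) -[1+ n ] (lower-q-negative (series (Ext (3 + q) w)) k n w)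

when : ∀ {p} {P : Set p} → Dec P → ℤ → ℤ
when (yes _) x = x
when (no _)  x = 0ℤ

when-yes : ∀ {p} {P : Set p} (d : Dec P) {x} → P → when d x ≡ x
when-yes (yes _) _ = refl
when-yes (no ¬p) p = ⊥-elim (¬p p)

when-no : ∀ {p} {P : Set p} (d : Dec P) {x} → ¬ P → when d x ≡ 0ℤ
when-no (yes p) ¬p = ⊥-elim (¬p p)
when-no (no _)  _  = refl

when-⇔ : ∀ {p q} {P : Set p} {Q : Set q} (d : Dec P) (e : Dec Q) {x} → (P → Q) → (Q → P) → when d x ≡ when e x
when-⇔ (yes p) e f g = sym (when-yes e (f p))
when-⇔ (no ¬p) e f g = sym (when-no e (λ q → ¬p (g q)))

when-* : ∀ {p} {P : Set p} c (d : Dec P) x → when d (c ℤ.* x) ≡ c ℤ.* when d x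
when-* c (yes _) x = refl
when-* c (no _)  x = sym (ℤP.*-zeroʳ c)

sumTo-+ : ∀ k (f g : ℕ → ℤ) → sumTo k (λ i → f i ℤ.+ g i) ≡ sumTo k f ℤ.+ sumTo k g
sumTo-+ zero    f g = refl
sumTo-+ (suc k) f g = trans (cong (ℤ._+ (f (suc k) ℤ.+ g (suc k))) (sumTo-+ k f g))
                            (interchange (sumTo k f) (sumTo k g) (f (suc k)) (g (suc k)))
  where
  interchange : ∀ a b c d → (a ℤ.+ b) ℤ.+ (c ℤ.+ d) ≡ (a ℤ.+ c) ℤ.+ (b ℤ.+ d)
  interchange = ℤSolver.solve-∀

sumTo-cong : ∀ k {f g : ℕ → ℤ} → (∀ i → f i ≡ g i) → sumTo k f ≡ sumTo k g
sumTo-cong zero    h = h 0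
sumTo-cong (suc k) h = cong₂ ℤ._+_ (sumTo-cong k h) (h (suc k))

sumTo-vanishing : ∀ k (f : ℕ → ℤ) → (∀ i → f i ≡ 0ℤ) → sumTo k f ≡ 0ℤ
sumTo-vanishing zero    f h = h 0
sumTo-vanishing (suc k) f h = cong₂ ℤ._+_ (sumTo-vanishing k f h) (h (suc k))

sumTo-point : ∀ k a (f : ℕ → ℤ) → (∀ i → i ≢ a → f i ≡ 0ℤ) → sumTo k f ≡ when (a ≤? k) (f a)
sumTo-point zero    zero    f h = refl
sumTo-point zero    (suc a) f h = h 0 (λ ())
sumTo-point (suc k) a       f h with a ≟ suc k
... | yes refl = trans (cong (ℤ._+ f (suc k)) (trans (sumTo-point k (suc k) f h)
                                                      (when-no (suc k ≤? k) (ℕP.<-irrefl refl))))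
                       (trans (ℤP.+-identityˡ _) (sym (when-yes (suc k ≤? suc k) ℕP.≤-refl)))
... | no a≢ = trans (cong₂ ℤ._+_ (sumTo-point k a f h) (h (suc k) (λ e → a≢ (sym e))))
                    (trans (ℤP.+-identityʳ _)
                           (when-⇔ (a ≤? k) (a ≤? suc k) ℕP.m≤n⇒m≤1+n
                                   (λ a≤ → ℕP.≤-pred (ℕP.≤∧≢⇒< a≤ a≢))))

monomial : ℤ → ℕ → ℕ → ℕ → ℕ → ℤ
monomial c a b i m with a ≟ i | b ≟ m
... | yes _ | yes _ = c
... | _     | _     = 0ℤ

poly-∷ : ∀ c a b ms k n → poly ((c , a , b) ∷ ms) k n ≡ monomial c a b k n ℤ.+ poly ms k n
poly-∷ c a b ms k n with a ≟ k | b ≟ n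
... | yes _ | yes _ = refl
... | yes _ | no _  = sym (ℤP.+-identityˡ _)
... | no _  | _     = sym (ℤP.+-identityˡ _)

monomial-off-x : ∀ c a b i m → i ≢ a → monomial c a b i m ≡ 0ℤ
monomial-off-x c a b i m i≢a with a ≟ i | b ≟ m
... | yes e | yes _ = ⊥-elim (i≢a (sym e))
... | yes _ | no _  = refl
... | no _  | _     = refl

monomial-off-q : ∀ c a b m → m ≢ b → monomial c a b a m ≡ 0ℤ
monomial-off-q c a b m m≢b with a ≟ a | b ≟ m
... | yes _ | yes e = ⊥-elim (m≢b (sym e))
... | yes _ | no _  = refl
... | no _  | _     = refl

monomial-at : ∀ c a b → monomial c a b a b ≡ c
monomial-at c a b with a ≟ a | b ≟ b
... | yes _ | yes _  = refl
... | yes _ | no b≢b = ⊥-elim (b≢b refl)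
... | no a≢a | _     = ⊥-elim (a≢a refl)

shifted-coeff : ∀ (H : FPS) k n a b → H ⟪ k ⊖ a , n ⊖ b ⟫ ≡ when (a ≤? k) (when (b ≤? n) (H (k ∸ a) (n ∸ b)))
shifted-coeff H k n a b with a ≤? k
... | no a≰k = trans (cong (λ x → H ⟪ x , n ⊖ b ⟫) (ℤP.⊖-< (ℕP.≰⇒> a≰k)))
                     (negative-x (ℕP.m<n⇒0<n∸m (ℕP.≰⇒> a≰k)))
  where
  negative-x : ∀ {r} → 0 < r → H ⟪ ℤ.- (+ r) , n ⊖ b ⟫ ≡ 0ℤ
  negative-x {suc r} _ = refl
... | yes a≤k with b ≤? n
...   | yes b≤n = cong₂ (λ x y → H ⟪ x , y ⟫) (ℤP.⊖-≥ a≤k) (ℤP.⊖-≥ b≤n)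
...   | no b≰n  = trans (cong₂ (λ x y → H ⟪ x , y ⟫) (ℤP.⊖-≥ a≤k) (ℤP.⊖-< (ℕP.≰⇒> b≰n)))
                        (negative-q (ℕP.m<n⇒0<n∸m (ℕP.≰⇒> b≰n)))
  where
  negative-q : ∀ {r} → 0 < r → H ⟪ + (k ∸ a) , ℤ.- (+ r) ⟫ ≡ 0ℤ
  negative-q {suc r} _ = refl

monomial-⊛ : ∀ (H : FPS) c a b k n →
  sumTo k (λ i → sumTo n (λ m → monomial c a b i m ℤ.* H (k ∸ i) (n ∸ m))) ≡ c ℤ.* H ⟪ k ⊖ a , n ⊖ b ⟫
monomial-⊛ H c a b k n = begin
  sumTo k (λ i → sumTo n (λ m → monomial c a b i m ℤ.* H (k ∸ i) (n ∸ m)))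
    ≡⟨ sumTo-point k a _ (λ i i≢a → sumTo-vanishing n _ (λ m → cong (ℤ._* H (k ∸ i) (n ∸ m)) (monomial-off-x c a b i m i≢a))) ⟩
  when (a ≤? k) (sumTo n (λ m → monomial c a b a m ℤ.* H (k ∸ a) (n ∸ m)))
    ≡⟨ cong (when (a ≤? k)) (sumTo-point n b _ (λ m m≢b → cong (ℤ._* H (k ∸ a) (n ∸ m)) (monomial-off-q c a b m m≢b))) ⟩
  when (a ≤? k) (when (b ≤? n) (monomial c a b a b ℤ.* H (k ∸ a) (n ∸ b)))
    ≡⟨ cong (λ z → when (a ≤? k) (when (b ≤? n) (z ℤ.* H (k ∸ a) (n ∸ b)))) (monomial-at c a b) ⟩
  when (a ≤? k) (when (b ≤? n) (c ℤ.* H (k ∸ a) (n ∸ b)))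
    ≡⟨ cong (when (a ≤? k)) (when-* c (b ≤? n) _) ⟩
  when (a ≤? k) (c ℤ.* when (b ≤? n) (H (k ∸ a) (n ∸ b)))
    ≡⟨ when-* c (a ≤? k) _ ⟩
  c ℤ.* when (a ≤? k) (when (b ≤? n) (H (k ∸ a) (n ∸ b)))
    ≡⟨ cong (c ℤ.*_) (sym (shifted-coeff H k n a b)) ⟩
  c ℤ.* H ⟪ k ⊖ a , n ⊖ b ⟫ ∎
  where open ≡-Reasoning

shiftedSum : FPS → List Mono → ℕ → ℕ → ℤ
shiftedSum H []                 k n = 0ℤ
shiftedSum H ((c , a , b) ∷ ms) k n = c ℤ.* H ⟪ k ⊖ a , n ⊖ b ⟫ ℤ.+ shiftedSum H ms k n

poly-⊛ : ∀ (H : FPS) ms k n → (poly ms ⊛ H) k n ≡ shiftedSum H ms k n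
poly-⊛ H []                 k n = sumTo-vanishing k _ (λ i → sumTo-vanishing n _ (λ m → refl))
poly-⊛ H ((c , a , b) ∷ ms) k n = begin
  sumTo k (λ i → sumTo n (λ m → poly ((c , a , b) ∷ ms) i m ℤ.* H (k ∸ i) (n ∸ m)))
    ≡⟨ sumTo-cong k (λ i → trans (sumTo-cong n (λ m → split i m)) (sumTo-+ n _ _)) ⟩
  sumTo k (λ i → sumTo n (λ m → monomial c a b i m ℤ.* H (k ∸ i) (n ∸ m))
                 ℤ.+ sumTo n (λ m → poly ms i m ℤ.* H (k ∸ i) (n ∸ m)))
    ≡⟨ sumTo-+ k (λ i → sumTo n (λ m → monomial c a b i m ℤ.* H (k ∸ i) (n ∸ m)))
                 (λ i → sumTo n (λ m → poly ms i m ℤ.* H (k ∸ i) (n ∸ m))) ⟩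
  sumTo k (λ i → sumTo n (λ m → monomial c a b i m ℤ.* H (k ∸ i) (n ∸ m))) ℤ.+ (poly ms ⊛ H) k n
    ≡⟨ cong₂ ℤ._+_ (monomial-⊛ H c a b k n) (poly-⊛ H ms k n) ⟩
  shiftedSum H ((c , a , b) ∷ ms) k n ∎
  where
  open ≡-Reasoning
  split : ∀ i m → poly ((c , a , b) ∷ ms) i m ℤ.* H (k ∸ i) (n ∸ m)
                ≡ monomial c a b i m ℤ.* H (k ∸ i) (n ∸ m) ℤ.+ poly ms i m ℤ.* H (k ∸ i) (n ∸ m)
  split i m = trans (cong (ℤ._* H (k ∸ i) (n ∸ m)) (poly-∷ c a b ms i m))
                    (ℤP.*-distribʳ-+ (H (k ∸ i) (n ∸ m)) (monomial c a b i m) (poly ms i m))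

G-split : ∀ x y → G ⟪ x , y ⟫ ≡ unit ⟪ x , y ⟫ ℤ.+ series (Tail 3) ⟪ x , y ⟫
G-split (+ k)      (+ n)      = trans (cong +_ (gCoeff-split k n)) (ℤP.pos-+ (unitCoeff k n) _)
G-split (+ k)      -[1+ n ]   = refl
G-split -[1+ k ]   y          = refl

G-translated-split : ∀ m x y → subst-xq (m * 3) G ⟪ x , y ⟫ ≡ unit ⟪ x , y ⟫ ℤ.+ series (Tail (m * 3 + 3)) ⟪ x , y ⟫
G-translated-split m (+ k) (+ n) with m * 3 * k ≤? n
... | yes fits = begin
  + gCoeff k (n ∸ m * 3 * k)
    ≡⟨ cong +_ (gCoeff-split k (n ∸ m * 3 * k)) ⟩
  + (unitCoeff k (n ∸ m * 3 * k) ℕ.+ Tail 3 k (n ∸ m * 3 * k))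
    ≡⟨ cong +_ (cong₂ ℕ._+_ (unit-translate k) (sym tail-translate)) ⟩
  + (unitCoeff k n ℕ.+ Tail (m * 3 + 3) k n)
    ≡⟨ ℤP.pos-+ (unitCoeff k n) _ ⟩
  + unitCoeff k n ℤ.+ + Tail (m * 3 + 3) k n ∎
  where
  open ≡-Reasoning
  unit-translate : ∀ k → unitCoeff k (n ∸ m * 3 * k) ≡ unitCoeff k n
  unit-translate zero    = cong (λ z → ind (n ∸ z ≟ 0)) (ℕP.*-zeroʳ (m * 3))
  unit-translate (suc k) = refl
  tail-translate : Tail (m * 3 + 3) k n ≡ Tail 3 k (n ∸ m * 3 * k)
  tail-translate = trans (Tail-translate-by m 3 k n)
                         (trans (cong (_* Tail 3 k (n ∸ m * 3 * k)) (ind-yes (m * 3 * k ≤? n) fits)) (ℕP.+-identityʳ _))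
... | no too-big = sym (cong₂ (λ u t → + u ℤ.+ + t) (unit-vanishes k too-big) tail-vanishes)
  where
  unit-vanishes : ∀ k → ¬ (m * 3 * k ≤ n) → unitCoeff k n ≡ 0
  unit-vanishes zero    too-big = ⊥-elim (too-big (subst (_≤ n) (sym (ℕP.*-zeroʳ (m * 3))) z≤n))
  unit-vanishes (suc k) _       = refl
  tail-vanishes : Tail (m * 3 + 3) k n ≡ 0
  tail-vanishes = trans (Tail-translate-by m 3 k n) (cong (_* Tail 3 k (n ∸ m * 3 * k)) (ind-no (m * 3 * k ≤? n) too-big))
G-translated-split m (+ k)    -[1+ n ] = refl
G-translated-split m -[1+ k ] y        = refl

data Atom : Set where
  one  : Atom
  tail : ℕ → Atom
  ext  : ℕ → ℕ → Atom

⟦_⟧ᵃ : Atom → FPS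
⟦ one ⟧ᵃ      = unit
⟦ tail v ⟧ᵃ   = series (Tail v)
⟦ ext L q ⟧ᵃ  = series (Ext L q)

_≟ᵃ_ : DecidableEquality Atom
one      ≟ᵃ one        = yes refl
tail v   ≟ᵃ tail v'    with v ℕ.≟ v'
... | yes refl = yes refl
... | no v≢    = no λ { refl → v≢ refl }
ext L q  ≟ᵃ ext L' q'  with L ℕ.≟ L' | q ℕ.≟ q'
... | yes refl | yes refl = yes refl
... | no L≢    | _        = no λ { refl → L≢ refl }
... | yes _    | no q≢    = no λ { refl → q≢ refl }
one      ≟ᵃ tail _     = no λ ()
one      ≟ᵃ ext _ _    = no λ ()
tail _   ≟ᵃ one        = no λ ()
tail _   ≟ᵃ ext _ _    = no λ ()
ext _ _  ≟ᵃ one        = no λ ()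
ext _ _  ≟ᵃ tail _     = no λ ()

-- (i , j , α) stands for x^i q^j α; an expression is a formal ℤ-linear combination.
Key : Set
Key = ℕ × ℕ × Atom

_≟ᵏ_ : DecidableEquality Key
_≟ᵏ_ = ≡-dec ℕ._≟_ (≡-dec ℕ._≟_ _≟ᵃ_)

Expr : Set
Expr = List (ℤ × Key)

evalWith : (Key → ℤ) → Expr → ℤ
evalWith ρ []            = 0ℤ
evalWith ρ ((c , κ) ∷ e) = c ℤ.* ρ κ ℤ.+ evalWith ρ e

evalWith-++ : ∀ ρ e e' → evalWith ρ (e ++ e') ≡ evalWith ρ e ℤ.+ evalWith ρ e'
evalWith-++ ρ []            e' = sym (ℤP.+-identityˡ _)
evalWith-++ ρ ((c , κ) ∷ e) e' =
  trans (cong (λ z → c ℤ.* ρ κ ℤ.+ z) (evalWith-++ ρ e e')) (sym (ℤP.+-assoc (c ℤ.* ρ κ) _ _))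

scale : ℤ → Expr → Expr
scale c []             = []
scale c ((c' , κ) ∷ e) = (c ℤ.* c' , κ) ∷ scale c e

evalWith-scale : ∀ ρ c e → evalWith ρ (scale c e) ≡ c ℤ.* evalWith ρ e
evalWith-scale ρ c []             = sym (ℤP.*-zeroʳ c)
evalWith-scale ρ c ((c' , κ) ∷ e) =
  trans (cong (λ z → c ℤ.* c' ℤ.* ρ κ ℤ.+ z) (evalWith-scale ρ c e)) (distribute c c' (ρ κ) (evalWith ρ e))
  where
  distribute : ∀ c c' x e → c ℤ.* c' ℤ.* x ℤ.+ c ℤ.* e ≡ c ℤ.* (c' ℤ.* x ℤ.+ e)
  distribute = ℤSolver.solve-∀

insert : ℤ × Key → Expr → Expr
insert (c , κ) []              = (c , κ) ∷ []
insert (c , κ) ((c' , κ') ∷ e) with κ ≟ᵏ κ'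
... | yes _ = (c ℤ.+ c' , κ') ∷ e
... | no _  = (c' , κ') ∷ insert (c , κ) e

collect : Expr → Expr
collect []      = []
collect (t ∷ e) = insert t (collect e)

evalWith-insert : ∀ ρ c κ e → evalWith ρ (insert (c , κ) e) ≡ c ℤ.* ρ κ ℤ.+ evalWith ρ e
evalWith-insert ρ c κ []              = refl
evalWith-insert ρ c κ ((c' , κ') ∷ e) with κ ≟ᵏ κ'
... | yes refl = merge c c' (ρ κ) (evalWith ρ e)
  where
  merge : ∀ c c' x e → (c ℤ.+ c') ℤ.* x ℤ.+ e ≡ c ℤ.* x ℤ.+ (c' ℤ.* x ℤ.+ e)
  merge = ℤSolver.solve-∀
... | no _     = trans (cong (λ z → c' ℤ.* ρ κ' ℤ.+ z) (evalWith-insert ρ c κ e))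
                       (swap c (ρ κ) c' (ρ κ') (evalWith ρ e))
  where
  swap : ∀ c x c' y e → c' ℤ.* y ℤ.+ (c ℤ.* x ℤ.+ e) ≡ c ℤ.* x ℤ.+ (c' ℤ.* y ℤ.+ e)
  swap = ℤSolver.solve-∀

evalWith-collect : ∀ ρ e → evalWith ρ (collect e) ≡ evalWith ρ e
evalWith-collect ρ []            = refl
evalWith-collect ρ ((c , κ) ∷ e) =
  trans (evalWith-insert ρ c κ (collect e)) (cong (λ z → c ℤ.* ρ κ ℤ.+ z) (evalWith-collect ρ e))

isZero : Expr → Bool
isZero []                  = true
isZero ((+ zero , _) ∷ e)  = isZero e
isZero ((+ suc _ , _) ∷ e) = false
isZero ((-[1+ _ ] , _) ∷ e) = false

isZero-evalWith : ∀ ρ e → T (isZero e) → evalWith ρ e ≡ 0ℤ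
isZero-evalWith ρ []                 _  = refl
isZero-evalWith ρ ((+ zero , κ) ∷ e) ok = trans (ℤP.+-identityˡ _) (isZero-evalWith ρ e ok)

shiftExpr : ℕ → ℕ → Expr → Expr
shiftExpr s r []                      = []
shiftExpr s r ((c , (i , j , α)) ∷ e) = (c , (i + s , j + r , α)) ∷ shiftExpr s r e

peelExpr : ℕ → Expr
peelExpr v = (1ℤ , (0 , 0 , tail v)) ∷ (-1ℤ , (1 , v , ext v v)) ∷ (-1ℤ , (0 , 0 , tail (suc v))) ∷ []

unfoldedNeg : ℕ → ℕ → Expr
unfoldedNeg L q = (-1ℤ , (0 , 0 , one)) ∷ placedTerm q ∷ placedTerm (1 + q) ∷ placedTerm (2 + q)
                ∷ (-1ℤ , (0 , 0 , tail (3 + q))) ∷ []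
  where
  placedTerm : ℕ → ℤ × Key
  placedTerm w = (ℤ.- (+ allowed L q w) , (1 , w , ext (3 + q) w))

unfoldExpr : ℕ → ℕ → Expr
unfoldExpr L q = (1ℤ , (0 , 0 , ext L q)) ∷ unfoldedNeg L q

onePlusTail : ℕ → List Mono → Expr
onePlusTail t []                 = []
onePlusTail t ((c , i , j) ∷ ms) = (c , (i , j , one)) ∷ (c , (i , j , tail t)) ∷ onePlusTail t ms

-- Tail u − Tail (u + 1), the series of the partitions with smallest part exactly u.
smallestIs : ℕ → Expr
smallestIs u = (1ℤ , (0 , 0 , tail u)) ∷ (-1ℤ , (0 , 0 , tail (suc u))) ∷ []

-- For 3 ∣ v, the partitions with smallest part exactly v, v + 1, v + 2:
--   Tail v − Tail (v + 1)       = x q^v (1 + Tail (v + 2)) + x² q^{2v} (1 + Tail (v + 3)),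
--   Tail (v + 1) − Tail (v + 2) = (x q^{v+1} + x² q^{2v+3}) (1 + Tail (v + 4))
--                                 + x² q^{2v+4} (1 + Tail (v + 6)) + x³ q^{3v+9} (1 + Tail (v + 7)),
--   Tail (v + 2) − Tail (v + 3) = x q^{v+2} (1 + Tail (v + 4)).
exactly₀Expr exactly₁Expr exactly₂Expr : ℕ → Expr
exactly₀Expr v = smallestIs v ++ onePlusTail (2 + v) ((-1ℤ , 1 , v) ∷ [])
                              ++ onePlusTail (3 + v) ((-1ℤ , 2 , 2 * v) ∷ [])
exactly₁Expr v = smallestIs (1 + v) ++ onePlusTail (4 + v) ((-1ℤ , 1 , 1 + v) ∷ (-1ℤ , 2 , 2 * v + 3) ∷ [])
                                    ++ onePlusTail (6 + v) ((-1ℤ , 2 , 2 * v + 4) ∷ [])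
                                    ++ onePlusTail (7 + v) ((-1ℤ , 3 , 3 * v + 9) ∷ [])
exactly₂Expr v = smallestIs (2 + v) ++ onePlusTail (4 + v) ((-1ℤ , 1 , 2 + v) ∷ [])

p₀-monomials p₃-monomials p₆-monomials p₉-monomials : List Mono
p₀-monomials = (1ℤ , 0 , 0) ∷ (1ℤ , 1 , 6) ∷ (1ℤ , 1 , 7) ∷ []
p₃-monomials = (-1ℤ , 0 , 0)
             ∷ (-1ℤ , 1 , 3) ∷ (-1ℤ , 1 , 4) ∷ (-1ℤ , 1 , 5) ∷ (-1ℤ , 1 , 6) ∷ (-1ℤ , 1 , 7)
             ∷ (-1ℤ , 2 , 6) ∷ (-1ℤ , 2 , 8) ∷ (ℤ.- (+ 2) , 2 , 9) ∷ (ℤ.- (+ 2) , 2 , 10)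
             ∷ (-1ℤ , 2 , 11) ∷ (-1ℤ , 2 , 12)
             ∷ (-1ℤ , 3 , 12) ∷ (-1ℤ , 3 , 13) ∷ (-1ℤ , 3 , 15) ∷ (-1ℤ , 3 , 16) ∷ []
p₆-monomials = (1ℤ , 3 , 16) ∷ (1ℤ , 3 , 17)
             ∷ (1ℤ , 4 , 20) ∷ (1ℤ , 4 , 21) ∷ (1ℤ , 4 , 22) ∷ (1ℤ , 4 , 23) ∷ (1ℤ , 4 , 24)
             ∷ (1ℤ , 5 , 27) ∷ (1ℤ , 5 , 28) ∷ []
p₉-monomials = (1ℤ , 5 , 36) ∷ (1ℤ , 6 , 39) ∷ (1ℤ , 6 , 40) ∷ []

-- p₀ G(x) + p₃ G(x q³) + p₆ G(x q⁶) + p₉ G(x q⁹), with G(x q^s) = 1 + Tail (s + 3).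
lhsExpr : Expr
lhsExpr = onePlusTail 3 p₀-monomials ++ (onePlusTail 6 p₃-monomials
       ++ (onePlusTail 9 p₆-monomials ++ onePlusTail 12 p₉-monomials))

module Coefficient (K N : ℕ) where

  value : ℕ → ℕ → Key → ℤ
  value a b (i , j , α) = ⟦ α ⟧ᵃ ⟪ K ⊖ (i + a) , N ⊖ (j + b) ⟫

  ⟦_⟧ : Expr → ℕ → ℕ → ℤ
  ⟦ e ⟧ a b = evalWith (value a b) e

  Vanishes : Expr → Set
  Vanishes e = ∀ a b → ⟦ e ⟧ a b ≡ 0ℤ

  ⟦shiftExpr⟧ : ∀ s r e a b → ⟦ shiftExpr s r e ⟧ a b ≡ ⟦ e ⟧ (s + a) (r + b)
  ⟦shiftExpr⟧ s r []                      a b = refl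
  ⟦shiftExpr⟧ s r ((c , (i , j , α)) ∷ e) a b =
    cong₂ (λ u v → c ℤ.* u ℤ.+ v)
          (cong₂ (λ x y → ⟦ α ⟧ᵃ ⟪ K ⊖ x , N ⊖ y ⟫) (ℕP.+-assoc i s a) (ℕP.+-assoc j r b))
          (⟦shiftExpr⟧ s r e a b)

  peel-vanishes : ∀ v → Vanishes (peelExpr v)
  peel-vanishes v a b = balance {e = series (Ext v v) ⟪ K ⊖ (1 + a) , N ⊖ (v + b) ⟫} {t' = series (Tail (suc v)) ⟪ K ⊖ a , N ⊖ b ⟫} (trans (Tail-peelℤ v (K ⊖ a) (N ⊖ b))
    (cong₂ (λ x y → series (Ext v v) ⟪ x , y ⟫ ℤ.+ series (Tail (suc v)) ⟪ K ⊖ a , N ⊖ b ⟫)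
           (sym (⊖-step K a 1)) (sym (⊖-step N b v))))
    where
    balance : ∀ {t e t'} → t ≡ e ℤ.+ t' → 1ℤ ℤ.* t ℤ.+ (-1ℤ ℤ.* e ℤ.+ (-1ℤ ℤ.* t' ℤ.+ 0ℤ)) ≡ 0ℤ
    balance {e = e} {t'} h = trans (cong (λ x → 1ℤ ℤ.* x ℤ.+ (-1ℤ ℤ.* e ℤ.+ (-1ℤ ℤ.* t' ℤ.+ 0ℤ))) h) (cancel e t')
      where
      cancel : ∀ e t' → 1ℤ ℤ.* (e ℤ.+ t') ℤ.+ (-1ℤ ℤ.* e ℤ.+ (-1ℤ ℤ.* t' ℤ.+ 0ℤ)) ≡ 0ℤ
      cancel = ℤSolver.solve-∀

  unfold-vanishes : ∀ L q → L ≤ 3 + q → Vanishes (unfoldExpr L q)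
  unfold-vanishes L q L≤ a b = balance (trans (Ext-unfoldℤ L q L≤ (K ⊖ a) (N ⊖ b))
    (cong (λ z → unit ⟪ K ⊖ a , N ⊖ b ⟫ ℤ.+ z)
      (cong₂ ℤ._+_ (lowered q) (cong₂ ℤ._+_ (lowered (1 + q)) (cong (ℤ._+ series (Tail (3 + q)) ⟪ K ⊖ a , N ⊖ b ⟫) (lowered (2 + q)))))))
    where
    shiftedExt : ℕ → ℤ
    shiftedExt w = series (Ext (3 + q) w) ⟪ K ⊖ (1 + a) , N ⊖ (w + b) ⟫
    lowered : ∀ w → placed L q w (K ⊖ a) (N ⊖ b) ≡ + allowed L q w ℤ.* shiftedExt w
    lowered w = cong₂ (λ x y → + allowed L q w ℤ.* series (Ext (3 + q) w) ⟪ x , y ⟫) (sym (⊖-step K a 1)) (sym (⊖-step N b w))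
    balance : series (Ext L q) ⟪ K ⊖ a , N ⊖ b ⟫
                ≡ unit ⟪ K ⊖ a , N ⊖ b ⟫ ℤ.+ (+ allowed L q q ℤ.* shiftedExt q ℤ.+ (+ allowed L q (1 + q) ℤ.* shiftedExt (1 + q)
                  ℤ.+ (+ allowed L q (2 + q) ℤ.* shiftedExt (2 + q) ℤ.+ series (Tail (3 + q)) ⟪ K ⊖ a , N ⊖ b ⟫))) →
              ⟦ unfoldExpr L q ⟧ a b ≡ 0ℤ
    balance h = trans (cong (λ x → 1ℤ ℤ.* x ℤ.+ evalWith (value a b) (unfoldedNeg L q)) h)
      (cancel (unit ⟪ K ⊖ a , N ⊖ b ⟫) (+ allowed L q q) (shiftedExt q) (+ allowed L q (1 + q)) (shiftedExt (1 + q))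
              (+ allowed L q (2 + q)) (shiftedExt (2 + q)) (series (Tail (3 + q)) ⟪ K ⊖ a , N ⊖ b ⟫))
      where
      cancel : ∀ d c₀ z₀ c₁ z₁ c₂ z₂ t →
        1ℤ ℤ.* (d ℤ.+ (c₀ ℤ.* z₀ ℤ.+ (c₁ ℤ.* z₁ ℤ.+ (c₂ ℤ.* z₂ ℤ.+ t))))
        ℤ.+ (-1ℤ ℤ.* d ℤ.+ ((ℤ.- c₀) ℤ.* z₀ ℤ.+ ((ℤ.- c₁) ℤ.* z₁ ℤ.+ ((ℤ.- c₂) ℤ.* z₂ ℤ.+ (-1ℤ ℤ.* t ℤ.+ 0ℤ))))) ≡ 0ℤ
      cancel = ℤSolver.solve-∀

  record Relation : Set where
    constructor relation
    field
      expr     : Expr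
      vanishes : Vanishes expr
  open Relation public

  shift : ℕ → ℕ → Relation → Relation
  shift s r R = relation (shiftExpr s r (expr R))
                         (λ a b → trans (⟦shiftExpr⟧ s r (expr R) a b) (vanishes R (s + a) (r + b)))

  peel : ℕ → Relation
  peel v = relation (peelExpr v) (peel-vanishes v)

  unfold : (d q : ℕ) → {T (d ≤ᵇ 3)} → Relation
  unfold d q {d≤3} = relation (unfoldExpr (d + q) q)
                              (unfold-vanishes (d + q) q (ℕP.+-monoˡ-≤ q (ℕP.≤ᵇ⇒≤ d 3 d≤3)))

  Certificate : Set
  Certificate = List (ℤ × Relation)

  combination : Certificate → Expr
  combination []             = []
  combination ((c , R) ∷ cs) = scale c (expr R) ++ combination cs

  combination-vanishes : ∀ cs → Vanishes (combination cs)
  combination-vanishes []             a b = refl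
  combination-vanishes ((c , R) ∷ cs) a b = begin
    ⟦ scale c (expr R) ++ combination cs ⟧ a b
      ≡⟨ evalWith-++ (value a b) (scale c (expr R)) (combination cs) ⟩
    ⟦ scale c (expr R) ⟧ a b ℤ.+ ⟦ combination cs ⟧ a b
      ≡⟨ cong₂ ℤ._+_ (evalWith-scale (value a b) c (expr R)) (combination-vanishes cs a b) ⟩
    c ℤ.* ⟦ expr R ⟧ a b ℤ.+ 0ℤ
      ≡⟨ cong (λ z → c ℤ.* z ℤ.+ 0ℤ) (vanishes R a b) ⟩
    c ℤ.* 0ℤ ℤ.+ 0ℤ
      ≡⟨ cong (ℤ._+ 0ℤ) (ℤP.*-zeroʳ c) ⟩
    0ℤ ∎
    where open ≡-Reasoning

  -- e vanishes when adding a combination of relations cancels it term by term;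
  -- the cancellation is checked by computation.
  derive : (e : Expr) (cs : Certificate) → {T (isZero (collect (e ++ combination cs)))} → Relation
  derive e cs {cancels} = relation e λ a b → begin
    ⟦ e ⟧ a b                                  ≡⟨ sym (ℤP.+-identityʳ _) ⟩
    ⟦ e ⟧ a b ℤ.+ 0ℤ                           ≡⟨ cong (λ z → ⟦ e ⟧ a b ℤ.+ z) (sym (combination-vanishes cs a b)) ⟩
    ⟦ e ⟧ a b ℤ.+ ⟦ combination cs ⟧ a b        ≡⟨ sym (evalWith-++ (value a b) e (combination cs)) ⟩
    ⟦ e ++ combination cs ⟧ a b                ≡⟨ sym (evalWith-collect (value a b) (e ++ combination cs)) ⟩
    ⟦ collect (e ++ combination cs) ⟧ a b      ≡⟨ isZero-evalWith (value a b) (collect (e ++ combination cs)) cancels ⟩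
    0ℤ ∎
    where open ≡-Reasoning

  _⊗_ : List Mono → Relation → Certificate
  []                ⊗ R = []
  ((c , a , b) ∷ f) ⊗ R = (c , shift a b R) ∷ (f ⊗ R)

  -- Certificates for the three relations above: peel off the smallest part and unfold
  -- the extensions above it until only Tail-series remain.
  exactly₀Cert exactly₁Cert exactly₂Cert : ℕ → Certificate
  exactly₀Cert v =
      (-1ℤ , peel v)
    ∷ (-1ℤ , shift 1 v (unfold 0 v))
    ∷ (1ℤ  , shift 1 v (peel (2 + v)))
    ∷ (-1ℤ , shift 2 (2 * v) (unfold 3 v))
    ∷ (-1ℤ , shift 2 (2 * v + 2) (unfold 1 (2 + v)))
    ∷ (1ℤ  , shift 2 (2 * v + 2) (unfold 0 (2 + v))) ∷ []
  exactly₁Cert v =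
      (-1ℤ , peel (1 + v))
    ∷ (-1ℤ , shift 1 (1 + v) (unfold 0 (1 + v)))
    ∷ (-1ℤ , shift 2 (2 * v + 3) (unfold 2 (2 + v)))
    ∷ (1ℤ  , shift 2 (2 * v + 3) (peel (4 + v)))
    ∷ (-1ℤ , shift 2 (2 * v + 4) (unfold 1 (3 + v)))
    ∷ (1ℤ  , shift 3 (3 * v + 7) (unfold 0 (4 + v)))
    ∷ (-1ℤ , shift 3 (3 * v + 7) (unfold 1 (4 + v)))
    ∷ (-1ℤ , shift 3 (3 * v + 9) (unfold 1 (5 + v)))
    ∷ (1ℤ  , shift 3 (3 * v + 9) (peel (7 + v)))
    ∷ (1ℤ  , shift 4 (4 * v + 16) (unfold 0 (7 + v)))
    ∷ (-1ℤ , shift 4 (4 * v + 16) (unfold 1 (7 + v))) ∷ []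
  exactly₂Cert v =
      (-1ℤ , peel (2 + v))
    ∷ (-1ℤ , shift 1 (2 + v) (unfold 0 (2 + v)))
    ∷ (1ℤ  , shift 1 (2 + v) (peel (4 + v)))
    ∷ (-1ℤ , shift 2 (2 * v + 6) (unfold 1 (4 + v)))
    ∷ (1ℤ  , shift 2 (2 * v + 6) (unfold 0 (4 + v))) ∷ []

  exactly₀ : (v : ℕ) → {T (isZero (collect (exactly₀Expr v ++ combination (exactly₀Cert v))))} → Relation
  exactly₀ v {cancels} = derive (exactly₀Expr v) (exactly₀Cert v) {cancels}

  exactly₁ : (v : ℕ) → {T (isZero (collect (exactly₁Expr v ++ combination (exactly₁Cert v))))} → Relation
  exactly₁ v {cancels} = derive (exactly₁Expr v) (exactly₁Cert v) {cancels}

  exactly₂ : (v : ℕ) → {T (isZero (collect (exactly₂Expr v ++ combination (exactly₂Cert v))))} → Relation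
  exactly₂ v {cancels} = derive (exactly₂Expr v) (exactly₂Cert v) {cancels}

  shiftedSum-onePlusTail : ∀ (H : FPS) t → (∀ x y → H ⟪ x , y ⟫ ≡ unit ⟪ x , y ⟫ ℤ.+ series (Tail t) ⟪ x , y ⟫) →
                           ∀ ms → shiftedSum H ms K N ≡ ⟦ onePlusTail t ms ⟧ 0 0
  shiftedSum-onePlusTail H t split []                 = refl
  shiftedSum-onePlusTail H t split ((c , i , j) ∷ ms) = begin
    c ℤ.* H ⟪ K ⊖ i , N ⊖ j ⟫ ℤ.+ shiftedSum H ms K N
      ≡⟨ cong₂ (λ u z → c ℤ.* u ℤ.+ z) (split (K ⊖ i) (N ⊖ j)) (shiftedSum-onePlusTail H t split ms) ⟩
    c ℤ.* (unit ⟪ K ⊖ i , N ⊖ j ⟫ ℤ.+ series (Tail t) ⟪ K ⊖ i , N ⊖ j ⟫) ℤ.+ ⟦ onePlusTail t ms ⟧ 0 0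
      ≡⟨ distribute c _ _ _ ⟩
    c ℤ.* unit ⟪ K ⊖ i , N ⊖ j ⟫ ℤ.+ (c ℤ.* series (Tail t) ⟪ K ⊖ i , N ⊖ j ⟫ ℤ.+ ⟦ onePlusTail t ms ⟧ 0 0)
      ≡⟨ cong₂ (λ x y → c ℤ.* unit ⟪ K ⊖ x , N ⊖ y ⟫ ℤ.+ (c ℤ.* series (Tail t) ⟪ K ⊖ x , N ⊖ y ⟫ ℤ.+ ⟦ onePlusTail t ms ⟧ 0 0))
               (sym (ℕP.+-identityʳ i)) (sym (ℕP.+-identityʳ j)) ⟩
    ⟦ onePlusTail t ((c , i , j) ∷ ms) ⟧ 0 0 ∎
    where
    open ≡-Reasoning
    distribute : ∀ c d t r → c ℤ.* (d ℤ.+ t) ℤ.+ r ≡ c ℤ.* d ℤ.+ (c ℤ.* t ℤ.+ r)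
    distribute = ℤSolver.solve-∀

  LHS-expansion : LHS K N ≡ ⟦ lhsExpr ⟧ 0 0
  LHS-expansion = begin
    LHS K N
      ≡⟨ cong₂ ℤ._+_ (term G 3 G-split p₀-monomials)
           (cong₂ ℤ._+_ (term (subst-xq 3 G) 6 (G-translated-split 1) p₃-monomials)
             (cong₂ ℤ._+_ (term (subst-xq 6 G) 9 (G-translated-split 2) p₆-monomials)
                          (term (subst-xq 9 G) 12 (G-translated-split 3) p₉-monomials))) ⟩
    ⟦ onePlusTail 3 p₀-monomials ⟧ 0 0 ℤ.+ (⟦ onePlusTail 6 p₃-monomials ⟧ 0 0
      ℤ.+ (⟦ onePlusTail 9 p₆-monomials ⟧ 0 0 ℤ.+ ⟦ onePlusTail 12 p₉-monomials ⟧ 0 0))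
      ≡⟨ sym (trans (evalWith-++ ρ (onePlusTail 3 p₀-monomials) (onePlusTail 6 p₃-monomials ++ (onePlusTail 9 p₆-monomials ++ onePlusTail 12 p₉-monomials)))
                    (cong (λ z → ⟦ onePlusTail 3 p₀-monomials ⟧ 0 0 ℤ.+ z)
                          (trans (evalWith-++ ρ (onePlusTail 6 p₃-monomials) (onePlusTail 9 p₆-monomials ++ onePlusTail 12 p₉-monomials))
                                 (cong (λ z → ⟦ onePlusTail 6 p₃-monomials ⟧ 0 0 ℤ.+ z)
                                       (evalWith-++ ρ (onePlusTail 9 p₆-monomials) (onePlusTail 12 p₉-monomials)))))) ⟩
    ⟦ lhsExpr ⟧ 0 0 ∎
    where
    open ≡-Reasoning
    ρ : Key → ℤ
    ρ = value 0 0
    term : ∀ H t → (∀ x y → H ⟪ x , y ⟫ ≡ unit ⟪ x , y ⟫ ℤ.+ series (Tail t) ⟪ x , y ⟫) →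
           ∀ ms → (poly ms ⊛ H) K N ≡ ⟦ onePlusTail t ms ⟧ 0 0
    term H t split ms = trans (poly-⊛ H ms K N) (shiftedSum-onePlusTail H t split ms)

  functionalEquation : Relation
  functionalEquation = derive lhsExpr
    ( (((-1ℤ , 0 , 0) ∷ (-1ℤ , 1 , 6) ∷ (-1ℤ , 1 , 7) ∷ []) ⊗ exactly₀ 3)
    ++ (((1ℤ , 1 , 4) ∷ (1ℤ , 1 , 5) ∷ (1ℤ , 2 , 8) ∷ (1ℤ , 2 , 9) ∷ (1ℤ , 2 , 10) ∷ (1ℤ , 2 , 11)
         ∷ (1ℤ , 2 , 12) ∷ (1ℤ , 3 , 15) ∷ (1ℤ , 3 , 16) ∷ []) ⊗ exactly₀ 6)
    ++ (((1ℤ , 3 , 18) ∷ (1ℤ , 4 , 21) ∷ (1ℤ , 4 , 22) ∷ []) ⊗ exactly₀ 9)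
    ++ (((-1ℤ , 0 , 0) ∷ (-1ℤ , 1 , 6) ∷ (-1ℤ , 1 , 7) ∷ []) ⊗ exactly₁ 3)
    ++ (((-1ℤ , 2 , 11) ∷ (-1ℤ , 3 , 14) ∷ (-1ℤ , 3 , 15) ∷ []) ⊗ exactly₁ 6)
    ++ (((-1ℤ , 0 , 0) ∷ (-1ℤ , 1 , 3) ∷ (-1ℤ , 1 , 6) ∷ (-1ℤ , 1 , 7) ∷ (-1ℤ , 2 , 9) ∷ (-1ℤ , 2 , 10) ∷ []) ⊗ exactly₂ 3)
    ++ (((1ℤ , 2 , 10) ∷ (1ℤ , 3 , 16) ∷ (1ℤ , 3 , 17) ∷ (1ℤ , 3 , 18) ∷ (1ℤ , 4 , 21) ∷ (1ℤ , 4 , 22) ∷ []) ⊗ exactly₂ 6)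
    ++ (((1ℤ , 4 , 27) ∷ (1ℤ , 5 , 30) ∷ (1ℤ , 5 , 31) ∷ []) ⊗ exactly₂ 9) )

mainTheorem8 : (k n : ℕ) → LHS k n ≡ 0ℤ
mainTheorem8 k n = begin
  LHS k n           ≡⟨ LHS-expansion ⟩
  ⟦ lhsExpr ⟧ 0 0   ≡⟨ vanishes functionalEquation 0 0 ⟩
  0ℤ ∎
  where
  open ≡-Reasoning
  open Coefficient k n
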